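{- Let $G$ be a graph, $X,Y$ disjoint subsets of $V(G)$, $r,\ell,t\in\mathbb{N}$ with $r\geqslant 3$, $\alpha>0$, let $T_1,\dots,T_\ell$ be trees, and set $C:=2^{\ell+3}\alpha^{ -1}\sum_{i=1}^\ell|T_i|$ and $s:=(2^\ell+r-3)t$. Suppose $(X,Y)$ is $(C,\alpha)$-rich in copies of $Z^{r,t}_\ell$, and fix sets $D(e_1,\dots,e_{j})$ witnessing this. Then for every $0\leqslant q\leqslant\ell$ and every $(e_1,\dots,e_q)\in\mathcal{D}_q(X,Y)$, the number of $S\in\mathcal{F}^{r,t}_\ell(Y)$ that are $(r,\ell,t,C,\alpha)$-good for $(e_1,\dots,e_q)$ and $(X,Y)$ is at least $2^{q-\ell}\alpha|Y|^s$. In particular, $(X,Y)$ is $(C,\alpha)$-dense in copies of $Z^{r,t}_\ell$.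
   Context: Notation: $[\ell]=\{1,\dots,\ell\}$; $N(v)$ is the neighbourhood of $v$; $E(X)$ is the set of edges of $G$ with both ends in $X$; for a set $D$ of edges, $G[D]$ is the graph on the endpoints of $D$ with edge set $D$, and $\delta(D)$, $\overline{d}(D)$ are its minimum and average degree. For $Y\subseteq V(G)$, $\mathcal{G}^{r,t}_\ell(Y)$ is the set of functions $S$ assigning to each $I\subseteq[\ell]$ a $t$-subset $S_I\subseteq Y$ and to each $j\in[r-3]$ a $t$-subset $S'_j\subseteq Y$. $S$ is proper if these sets are pairwise disjoint, each $S_I$ is completely joined to each $S'_j$, and $S'_j$ is completely joined to $S'_{j'}$ for $j\neq j'$; $\mathcal{F}^{r,t}_\ell(Y)$ is the set of proper $S$. For an ordered pair $(x,y)$ and $i\in[\ell]$, $(x,y)\to_i S$ means $S'_j\subseteq N(x)\cap N(y)$ for all $j$, $S_I\subseteq N(x)$ for all $I\ni i$, $S_I\subseteq N(y)$ for all $I\not\ni i$; for an edge $e=xy$, $e\to_i S$ means $(x,y)\to_i S$ or $(y,x)\to_i S$; $(e_1,\dots,e_\ell)\to S$ means $e_i\to_i S$ for all $i$. $(X,Y)$ is $(C,\alpha)$-rich in copies of $Z^{r,t}_\ell$ if there exist a set $D=D()\subseteq E(X)$ and, for each $1\leqslant j\leqslant \ell-1$ and all $e_1\in D(),e_2\in D(e_1),\dots,e_j\in D(e_1,\dots,e_{j-1})$, a set $D(e_1,\dots,e_j)\subseteq E(X)$, such that for all $e_1\in D, \dots, e_\ell\in D(e_1,\dots,e_{\ell-1})$: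 (a) $\delta(D),\delta(D(e_1)),\dots,\delta(D(e_1,\dots,e_{\ell-1}))>C$; (b) at least $\alpha|Y|^s$ functions $S\in\mathcal{F}^{r,t}_\ell(Y)$ satisfy $(e_1,\dots,e_\ell)\to S$. Given such witnessing sets, $\mathcal{D}_q(X,Y)$ is the set of $q$-tuples $(e_1,\dots,e_q)$ of edges with $e_j\in D(e_1,\dots,e_{j-1})$ for each $j\in[q]$ ($\mathcal{D}_0$ consists of the empty tuple). $S\in\mathcal{F}^{r,t}_\ell(Y)$ is $(r,\ell,t,C,\alpha)$-good for $(e_1,\dots,e_q)$ and $(X,Y)$ if there exist $E_{q+1},\dots,E_\ell\subseteq E(X)$ with $\overline{d}(E_j)\geqslant 2^{ -\ell}\alpha C$ for each $q+1\leqslant j\leqslant\ell$ such that $(e_1,\dots,e_\ell)\to S$ for all $e_{q+1}\in E_{q+1},\dots,e_\ell\in E_\ell$; "good for $(X,Y)$" means good for the empty tuple. $(X,Y)$ is $(C,\alpha)$-dense in copies of $Z^{r,t}_\ell$ if at least $2^{ -\ell}\alpha|Y|^s$ functions $S\in\mathcal{F}^{r,t}_\ell(Y)$ are $(r,\ell,t,C,\alpha)$-good for $(X,Y)$.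
   Formalization: The parameter α ranges over the positive rationals, so the constant C is rational as well. -}

module Defs where

open import Data.Bool using (Bool; true; false; _∧_; not)
open import Data.Nat as ℕ using (ℕ; zero; suc; _+_; _*_; _∸_; _^_; _≤_; _<_; _⊓_)
open import Data.Nat.Properties using (m^n≢0)
open import Data.Fin using (Fin; toℕ)
open import Data.Fin.Subset using (Subset; _∈_; _∉_; _⊆_; ∣_∣)
open import Data.Vec using (tabulate)
open import Data.List using (List; []; _∷_; length; map; foldr; filter; lookup; take; _++_; [_])
open import Data.List.Relation.Unary.All using (All)
open import Data.List.Relation.Unary.Unique.Propositional using (Unique)
open import Data.List.Relation.Unary.Linked using (Linked)
open import Data.List.Relation.Binary.Pointwise using ()
open import Data.List.Relation.Unary.AllPairs using (AllPairs)
open import Data.Maybe using (Maybe; just; nothing)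
open import Data.Product using (Σ; ∃; _×_; _,_)
open import Data.Sum using (_⊎_)
open import Data.Empty using (⊥)
open import Relation.Nullary using (¬_)
open import Relation.Binary.PropositionalEquality using (_≡_; _≢_)
open import Data.Integer using (+_)
open import Data.Rational as ℚ using (ℚ; _/_; 1/_; Positive)
import Data.Rational.Unnormalised.Properties as ℚᵘP
import Data.List.Properties
open import Data.Nat using (_<ᵇ_)
open import Data.Nat.ListAction using (sum)

record Graph (n : ℕ) : Set where
  field
    adj    : Fin n → Fin n → Bool
    sym    : ∀ x y → adj x y ≡ adj y x
    irrefl : ∀ x → adj x x ≡ false
open Graph public

N : ∀ {n} → Graph n → Fin n → Subset n
N G x = tabulate (adj G x)

data Reach {n} (G : Graph n) : Fin n → Fin n → Set where
  here : ∀ {x} → Reach G x x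
  step : ∀ {x y z} → adj G x z ≡ true → Reach G z y → Reach G x y

Connected : ∀ {n} → Graph n → Set
Connected G = ∀ x y → Reach G x y

-- a cycle: distinct vertices v , w₁ , … , w_k  (k ≥ 2) with consecutive
-- vertices adjacent and w_k adjacent to v (closed walk v w₁ … w_k v)
IsCycle : ∀ {n} → Graph n → Fin n → List (Fin n) → Set
IsCycle G v ws =
  (2 ≤ length ws) × Unique (v ∷ ws) ×
  Linked (λ a b → adj G a b ≡ true) (v ∷ ws ++ [ v ])

Acyclic : ∀ {n} → Graph n → Set
Acyclic G = ∀ v ws → ¬ IsCycle G v ws

IsTree : ∀ {n} → Graph n → Set
IsTree {n} G = (1 ≤ n) × Connected G × Acyclic G

-- Sets of edges, represented by their (symmetric) indicator matrix

EdgeSet : ℕ → Set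
EdgeSet n = Fin n → Fin n → Bool

EdgeSetIn : ∀ {n} → Graph n → Subset n → EdgeSet n → Set
EdgeSetIn G X D =
  (∀ x y → D x y ≡ D y x) ×
  (∀ x y → D x y ≡ true → (adj G x y ≡ true) × (x ∈ X) × (y ∈ X))

-- an (unordered) edge xy, stored with x < y
record Edge (n : ℕ) : Set where
  constructor edge
  field
    u v : Fin n
    u<v : toℕ u < toℕ v
open Edge public

_∈E_ : ∀ {n} → Edge n → EdgeSet n → Set
e ∈E D = D (u e) (v e) ≡ true

deg : ∀ {n} → EdgeSet n → Fin n → ℕ
deg D x = ∣ tabulate (D x) ∣

-- the degrees of the vertices of G[D] (vertices meeting an edge of D)
degreesOf : ∀ {n} → EdgeSet n → List ℕ
degreesOf {n} D =
  filter (λ d → 1 ℕ.≤? d) (map (deg D) (Data.List.allFin n))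

-- minimum degree δ(D) of G[D]  (convention: 0 for the empty graph)
δ : ∀ {n} → EdgeSet n → ℕ
δ D with degreesOf D
... | []     = 0
... | d ∷ ds = foldr _⊓_ d ds

numVertices : ∀ {n} → EdgeSet n → ℕ
numVertices D = length (degreesOf D)

numEdges : ∀ {n} → EdgeSet n → ℕ
numEdges {n} D =
  sum (map (λ x → ∣ tabulate (λ y → D x y ∧ (toℕ x <ᵇ toℕ y)) ∣)
           (Data.List.allFin n))

AvgDegAtLeast : ∀ {n} → EdgeSet n → ℚ → Set
AvgDegAtLeast D c =
  Σ (1 ≤ numVertices D) λ p →
    c ℚ.≤ ((+ (2 * numEdges D)) / numVertices D) {{ℕ.>-nonZero p}}

fromℕ : ℕ → ℚ
fromℕ k = (+ k) / 1

2^-_ : ℕ → ℚ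
2^- k = ((+ 1) / (2 ^ k)) {{m^n≢0 2 k}}

inv : (α : ℚ) → Positive α → ℚ
inv α p = (1/ α) {{ℚᵘP.pos⇒nonZero (ℚ.toℚᵘ α) {{p}}}}

-- The functions S ∈ 𝒢^{r,t}_ℓ(Y)

record Zfun (r ℓ n : ℕ) : Set where
  field
    SI : Subset ℓ → Subset n
    S' : Fin (r ∸ 3) → Subset n
open Zfun public

DisjointS : ∀ {n} → Subset n → Subset n → Set
DisjointS A B = ∀ x → x ∈ A → x ∈ B → ⊥

Complete : ∀ {n} → Graph n → Subset n → Subset n → Set
Complete G A B = ∀ x y → x ∈ A → y ∈ B → adj G x y ≡ true

InG : ∀ {r ℓ n} → Subset n → ℕ → Zfun r ℓ n → Set
InG Y t S =
  (∀ I → (∣ SI S I ∣ ≡ t) × (SI S I ⊆ Y)) ×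
  (∀ j → (∣ S' S j ∣ ≡ t) × (S' S j ⊆ Y))

Proper : ∀ {r ℓ n} → Graph n → Zfun r ℓ n → Set
Proper G S =
  (∀ I I' → I ≢ I' → DisjointS (SI S I) (SI S I')) ×
  (∀ I j → DisjointS (SI S I) (S' S j)) ×
  (∀ j j' → j ≢ j' → DisjointS (S' S j) (S' S j')) ×
  (∀ I j → Complete G (SI S I) (S' S j)) ×
  (∀ j j' → j ≢ j' → Complete G (S' S j) (S' S j'))

InF : ∀ {r ℓ n} → Graph n → Subset n → ℕ → Zfun r ℓ n → Set
InF G Y t S = InG Y t S × Proper G S

PairArrow : ∀ {r ℓ n} → Graph n → Fin n → Fin n → Fin ℓ → Zfun r ℓ n → Set
PairArrow G x y i S =
  (∀ j → (S' S j ⊆ N G x) × (S' S j ⊆ N G y)) ×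
  (∀ I → i ∈ I → SI S I ⊆ N G x) ×
  (∀ I → i ∉ I → SI S I ⊆ N G y)

EdgeArrow : ∀ {r ℓ n} → Graph n → Edge n → Fin ℓ → Zfun r ℓ n → Set
EdgeArrow G e i S = PairArrow G (u e) (v e) i S ⊎ PairArrow G (v e) (u e) i S

nth : ∀ {A : Set} → List A → ℕ → Maybe A
nth []       _       = nothing
nth (x ∷ xs) zero    = just x
nth (x ∷ xs) (suc k) = nth xs k

TupleArrow : ∀ {r ℓ n} → Graph n → List (Edge n) → Zfun r ℓ n → Set
TupleArrow {ℓ = ℓ} G es S =
  (length es ≡ ℓ) ×
  (∀ (i : Fin ℓ) e → nth es (toℕ i) ≡ just e → EdgeArrow G e i S)

-- "at least N functions S satisfy P": a list of at least N pairwise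
-- distinct such S

Distinct : ∀ {r ℓ n} → Zfun r ℓ n → Zfun r ℓ n → Set
Distinct S T = (∃ λ I → SI S I ≢ SI T I) ⊎ (∃ λ j → S' S j ≢ S' T j)

AtLeast : ∀ {r ℓ n} → ℚ → (Zfun r ℓ n → Set) → Set
AtLeast {r} {ℓ} {n} M P =
  Σ (List (Zfun r ℓ n)) λ L →
    AllPairs Distinct L × All P L × (M ℚ.≤ fromℕ (length L))

-- witnessing families D(e₁,…,e_j), indexed by the list [e₁,…,e_j]

DFam : ℕ → Set
DFam n = List (Edge n) → EdgeSet n

-- (e₁,…,e_q) ∈ 𝒟_q(X,Y):  e_j ∈ D(e₁,…,e_{j-1}) for all j
InChain : ∀ {n} → DFam n → List (Edge n) → Set
InChain D es = ∀ (k : Fin (length es)) → lookup es k ∈E D (take (toℕ k) es)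

sParam : ℕ → ℕ → ℕ → ℕ
sParam r ℓ t = (2 ^ ℓ + (r ∸ 3)) * t

RichWitness : ∀ {n} → Graph n → Subset n → Subset n →
              (r ℓ t : ℕ) → (C α : ℚ) → DFam n → Set
RichWitness {n} G X Y r ℓ t C α D =
  (∀ es → EdgeSetIn G X (D es)) ×
  (∀ es → InChain D es → length es < ℓ → C ℚ.< fromℕ (δ (D es))) ×
  (∀ es → InChain D es → length es ≡ ℓ →
     AtLeast {r} {ℓ} {n} (α ℚ.* fromℕ (∣ Y ∣ ^ sParam r ℓ t))
             (λ S → InF G Y t S × TupleArrow G es S))

Rich : ∀ {n} → Graph n → Subset n → Subset n →
       (r ℓ t : ℕ) → (C α : ℚ) → Set
Rich G X Y r ℓ t C α = Σ (DFam _) (RichWitness G X Y r ℓ t C α)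

-- S is (r,ℓ,t,C,α)-good for (e₁,…,e_q) (the list es, q = length es)
-- and (X,Y).  E k (for q ≤ k < ℓ, 0-based) plays the role of E_{k+1}.
Good : ∀ {r ℓ n} → Graph n → Subset n → Subset n → ℕ → (C α : ℚ) →
       List (Edge n) → Zfun r ℓ n → Set
Good {r} {ℓ} {n} G X Y t C α es S =
  InF G Y t S ×
  Σ (Fin ℓ → EdgeSet n) λ E →
    (∀ k → length es ≤ toℕ k →
       EdgeSetIn G X (E k) × AvgDegAtLeast (E k) ((2^- ℓ) ℚ.* α ℚ.* C)) ×
    (∀ (fs : List (Edge n)) → length (es ++ fs) ≡ ℓ →
       (∀ (k : Fin ℓ) e → length es ≤ toℕ k →
          nth (es ++ fs) (toℕ k) ≡ just e → e ∈E E k) →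
       TupleArrow G (es ++ fs) S)

Dense : ∀ {n} → Graph n → Subset n → Subset n →
        (r ℓ t : ℕ) → (C α : ℚ) → Set
Dense {n} G X Y r ℓ t C α =
  AtLeast {r} {ℓ} {n} ((2^- ℓ) ℚ.* α ℚ.* fromℕ (∣ Y ∣ ^ sParam r ℓ t))
          (Good G X Y t C α [])

Cconst : (ℓ : ℕ) (α : ℚ) → Positive α → (Fin ℓ → ℕ) → ℚ
Cconst ℓ α p m =
  fromℕ (2 ^ (ℓ + 3)) ℚ.* inv α p ℚ.* fromℕ (sum (map m (Data.List.allFin ℓ)))

module Submission where

-- We prove, by induction on the number m = ℓ - q of edges still to be chosen,
-- a stronger count: S ∈ ℱ is "strongly good" for (e₁,…,e_q) if e_i →_i S for
-- i ≤ q and every later position k carries a set E_k of average degree at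
-- least 2^{-ℓ} α C all of whose edges e satisfy e →_k S.  For m = 0 this is
-- richness.  For m + 1, let D = D(e₁,…,e_q); every edge xy of D contributes
-- 2^{-m} α |Y|^s functions strongly good for (e₁,…,e_q,xy).  Gather them into
-- W (at most |Y|^s up to equivalence) and call S good if the edges B_S of D
-- with xy →_{q+1} S have average degree at least 2^{-ℓ} α C; good functions
-- are strongly good for (e₁,…,e_q) with E_{q+1} = B_S.  Since δ(D) > C, a bad
-- B_S has at most 2^{-ℓ} α |D| edges, so double counting the pairs (S , xy)
-- gives |D| 2^{-m} α |Y|^s ≤ |good| |D| + |Y|^s 2^{-ℓ} α |D|, whence
-- |good| ≥ 2^{-(m+1)} α |Y|^s.

open import Data.Nat using (ℕ)
open import Data.Fin.Subset using (Subset)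
open import Data.Rational as ℚ using (ℚ; 0ℚ)
open import Defs using (Graph; DFam; RichWitness)

module FiniteSums where

  open import Data.Bool as Bool using (Bool; true; false; if_then_else_)
  open import Data.Nat as ℕ using (ℕ; zero; suc; _+_; _*_; _≤_)
  import Data.Nat.Properties as ℕP
  open import Algebra.Properties.CommutativeSemigroup ℕP.+-commutativeSemigroup
    using () renaming (interchange to +-interchange)
  open import Data.Nat.ListAction using (sum)
  open import Data.Fin as Fin using (Fin)
  open import Data.Fin.Subset using (∣_∣)
  import Data.Vec as Vec
  open import Data.List using (List; []; _∷_; _++_; map; length; allFin; filter; cartesianProduct)
  import Data.List.Properties as ListP
  open import Data.List.Membership.Propositional using (_∈_)
  open import Data.List.Relation.Unary.Any using (here; there)
  open import Data.Product using (_,_)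
  open import Relation.Nullary using (Dec; yes; no; does)
  open import Relation.Unary using (Decidable)
  open import Function using (_∘_)
  open import Relation.Binary.PropositionalEquality

  private
    variable
      A B : Set

  ∑ : List A → (A → ℕ) → ℕ
  ∑ xs f = sum (map f xs)

  syntax ∑ xs (λ x → e) = ∑[ x ∈ xs ] e

  𝟙 : Bool → ℕ
  𝟙 true  = 1
  𝟙 false = 0

  𝟙-mono : ∀ {a b} → (a ≡ true → b ≡ true) → 𝟙 a ≤ 𝟙 b
  𝟙-mono {false} _   = ℕ.z≤n
  𝟙-mono {true}  a⇒b rewrite a⇒b refl = ℕP.≤-refl

  𝟙-does-mono : ∀ {P : Set} {b} (P? : Dec P) → (P → b ≡ true) → 𝟙 (does P?) ≤ 𝟙 b
  𝟙-does-mono (yes p) P⇒b = 𝟙-mono (λ _ → P⇒b p)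
  𝟙-does-mono (no _)  _   = ℕ.z≤n

  ∑-cong : ∀ (xs : List A) {f g : A → ℕ} → (∀ x → f x ≡ g x) → ∑ xs f ≡ ∑ xs g
  ∑-cong []       f≗g = refl
  ∑-cong (x ∷ xs) f≗g = cong₂ _+_ (f≗g x) (∑-cong xs f≗g)

  ∑-mono : ∀ (xs : List A) {f g : A → ℕ} → (∀ {x} → x ∈ xs → f x ≤ g x) → ∑ xs f ≤ ∑ xs g
  ∑-mono []       f≤g = ℕ.z≤n
  ∑-mono (x ∷ xs) f≤g = ℕP.+-mono-≤ (f≤g (here refl)) (∑-mono xs (f≤g ∘ there))

  ∑-zero : ∀ (xs : List A) → ∑[ x ∈ xs ] 0 ≡ 0
  ∑-zero []       = refl
  ∑-zero (x ∷ xs) = ∑-zero xs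

  ∑-distrib-+ : ∀ (xs : List A) (f g : A → ℕ) → ∑[ x ∈ xs ] (f x + g x) ≡ ∑ xs f + ∑ xs g
  ∑-distrib-+ []       f g = refl
  ∑-distrib-+ (x ∷ xs) f g = trans (cong (f x + g x +_) (∑-distrib-+ xs f g))
    (+-interchange (f x) (g x) (∑ xs f) (∑ xs g))

  ∑-*ʳ : ∀ (xs : List A) (f : A → ℕ) c → ∑[ x ∈ xs ] (f x * c) ≡ ∑ xs f * c
  ∑-*ʳ []       f c = refl
  ∑-*ʳ (x ∷ xs) f c = trans (cong (f x * c +_) (∑-*ʳ xs f c)) (sym (ℕP.*-distribʳ-+ c (f x) (∑ xs f)))

  ∑-++ : ∀ (xs ys : List A) f → ∑ (xs ++ ys) f ≡ ∑ xs f + ∑ ys f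
  ∑-++ []       ys f = refl
  ∑-++ (x ∷ xs) ys f = trans (cong (f x +_) (∑-++ xs ys f)) (sym (ℕP.+-assoc (f x) (∑ xs f) (∑ ys f)))

  ∑-cartesianProduct : ∀ (xs : List A) (ys : List B) f →
    ∑ (cartesianProduct xs ys) f ≡ ∑[ x ∈ xs ] ∑[ y ∈ ys ] f (x , y)
  ∑-cartesianProduct []       ys f = refl
  ∑-cartesianProduct (x ∷ xs) ys f = begin
    ∑ (map (x ,_) ys ++ cartesianProduct xs ys) f               ≡⟨ ∑-++ (map (x ,_) ys) _ f ⟩
    ∑ (map (x ,_) ys) f + ∑ (cartesianProduct xs ys) f          ≡⟨ cong₂ _+_ (cong sum (sym (ListP.map-∘ ys)))
                                                                             (∑-cartesianProduct xs ys f) ⟩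
    ∑[ y ∈ ys ] f (x , y) + ∑[ x ∈ xs ] ∑[ y ∈ ys ] f (x , y)   ∎
    where open ≡-Reasoning

  ∑-swap : ∀ (xs : List A) (ys : List B) (f : A → B → ℕ) →
    ∑[ x ∈ xs ] ∑[ y ∈ ys ] f x y ≡ ∑[ y ∈ ys ] ∑[ x ∈ xs ] f x y
  ∑-swap []       ys f = sym (∑-zero ys)
  ∑-swap (x ∷ xs) ys f = trans (cong (∑ ys (f x) +_) (∑-swap xs ys f)) (sym (∑-distrib-+ ys (f x) _))

  length-filter : ∀ {P : A → Set} (P? : Decidable P) xs → length (filter P? xs) ≡ ∑[ x ∈ xs ] 𝟙 (does (P? x))
  length-filter P? []       = refl
  length-filter P? (x ∷ xs) with does (P? x)
  ... | true  = cong suc (length-filter P? xs)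
  ... | false = length-filter P? xs

  ∑-allFin-suc : ∀ n (f : Fin (suc n) → ℕ) → ∑ (allFin (suc n)) f ≡ f Fin.zero + ∑ (allFin n) (f ∘ Fin.suc)
  ∑-allFin-suc n f = cong (λ xs → f Fin.zero + sum xs)
    (trans (ListP.map-tabulate Fin.suc f) (sym (ListP.map-tabulate (λ x → x) (f ∘ Fin.suc))))

  ∣tabulate∣ : ∀ n (f : Fin n → Bool) → ∣ Vec.tabulate f ∣ ≡ ∑[ x ∈ allFin n ] 𝟙 (f x)
  ∣tabulate∣ zero    f = refl
  ∣tabulate∣ (suc n) f = trans (first (f Fin.zero)) (sym (∑-allFin-suc n (𝟙 ∘ f)))
    where
    first : ∀ b → (if does (b Bool.≟ true) then suc else (λ k → k)) ∣ Vec.tabulate (f ∘ Fin.suc) ∣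
                  ≡ 𝟙 b + ∑ (allFin n) (𝟙 ∘ f ∘ Fin.suc)
    first true  = cong suc (∣tabulate∣ n (f ∘ Fin.suc))
    first false = ∣tabulate∣ n (f ∘ Fin.suc)

module Rationals where

  open import Defs using (fromℕ; 2^-_)
  open FiniteSums using (∑)
  open import Data.Nat as ℕ using (ℕ; zero; suc)
  import Data.Nat.Properties as ℕP
  open import Data.Integer as ℤ using (ℤ; +_)
  import Data.Integer.Properties as ℤP
  open import Data.Rational as ℚ using (ℚ; 0ℚ; 1ℚ; toℚᵘ; Positive; _+_; _*_; _≤_)
  import Data.Rational.Properties as ℚP
  open import Data.Rational.Unnormalised as ℚᵘ using (mkℚᵘ; *≡*; *≤*)
  import Data.Rational.Unnormalised.Properties as ℚᵘP
  open import Data.Rational.Solver using (module +-*-Solver)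
  open import Relation.Nullary using (¬_)
  open import Data.List using (List; []; _∷_; length)
  open import Data.Product using (_,_)
  open import Relation.Binary.PropositionalEquality

  open +-*-Solver using (solve; _:=_; _:+_; _:*_; :-_; con)

  toℚᵘ-/ : ∀ (i : ℤ) (d : ℕ) → toℚᵘ (i ℚ./ suc d) ℚᵘ.≃ mkℚᵘ i d
  toℚᵘ-/ i d = ℚP.toℚᵘ-fromℚᵘ (mkℚᵘ i d)

  toℚᵘ-fromℕ : ∀ a → toℚᵘ (fromℕ a) ℚᵘ.≃ mkℚᵘ (+ a) 0
  toℚᵘ-fromℕ a = toℚᵘ-/ (+ a) 0

  fromℕ-+ : ∀ a b → fromℕ (a ℕ.+ b) ≡ fromℕ a + fromℕ b
  fromℕ-+ a b = ℚP.toℚᵘ-injective (begin-equality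
    toℚᵘ (fromℕ (a ℕ.+ b))               ≃⟨ toℚᵘ-fromℕ (a ℕ.+ b) ⟩
    mkℚᵘ (+ (a ℕ.+ b)) 0                 ≃⟨ *≡* (cong (ℤ._* + 1) (trans (ℤP.pos-+ a b)
                                               (sym (cong₂ ℤ._+_ (ℤP.*-identityʳ (+ a)) (ℤP.*-identityʳ (+ b)))))) ⟩
    mkℚᵘ (+ a) 0 ℚᵘ.+ mkℚᵘ (+ b) 0       ≃⟨ ℚᵘP.+-cong (toℚᵘ-fromℕ a) (toℚᵘ-fromℕ b) ⟨
    toℚᵘ (fromℕ a) ℚᵘ.+ toℚᵘ (fromℕ b)   ≃⟨ ℚP.toℚᵘ-homo-+ (fromℕ a) (fromℕ b) ⟨
    toℚᵘ (fromℕ a + fromℕ b)             ∎)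
    where open ℚᵘP.≤-Reasoning

  fromℕ-* : ∀ a b → fromℕ (a ℕ.* b) ≡ fromℕ a * fromℕ b
  fromℕ-* a b = ℚP.toℚᵘ-injective (begin-equality
    toℚᵘ (fromℕ (a ℕ.* b))               ≃⟨ toℚᵘ-fromℕ (a ℕ.* b) ⟩
    mkℚᵘ (+ (a ℕ.* b)) 0                 ≃⟨ *≡* (cong (ℤ._* + 1) (ℤP.pos-* a b)) ⟩
    mkℚᵘ (+ a) 0 ℚᵘ.* mkℚᵘ (+ b) 0       ≃⟨ ℚᵘP.*-cong (toℚᵘ-fromℕ a) (toℚᵘ-fromℕ b) ⟨
    toℚᵘ (fromℕ a) ℚᵘ.* toℚᵘ (fromℕ b)   ≃⟨ ℚP.toℚᵘ-homo-* (fromℕ a) (fromℕ b) ⟨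
    toℚᵘ (fromℕ a * fromℕ b)             ∎)
    where open ℚᵘP.≤-Reasoning

  fromℕ-mono : ∀ {a b} → a ℕ.≤ b → fromℕ a ≤ fromℕ b
  fromℕ-mono {a} {b} a≤b = ℚP.toℚᵘ-cancel-≤ (begin
    toℚᵘ (fromℕ a)  ≃⟨ toℚᵘ-fromℕ a ⟩
    mkℚᵘ (+ a) 0    ≤⟨ *≤* (ℤP.*-monoʳ-≤-nonNeg (+ 1) (ℤ.+≤+ a≤b)) ⟩
    mkℚᵘ (+ b) 0    ≃⟨ toℚᵘ-fromℕ b ⟨
    toℚᵘ (fromℕ b)  ∎)
    where open ℚᵘP.≤-Reasoning

  fromℕ-nonNeg : ∀ a → 0ℚ ≤ fromℕ a
  fromℕ-nonNeg a = fromℕ-mono {0} {a} ℕ.z≤n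

  fromℕ-pos : ∀ a → Positive (fromℕ (suc a))
  fromℕ-pos a = ℚP.normalize-pos (suc a) 1

  module _ {A : Set} where
    open ℚP.≤-Reasoning

    ∑-scaled-≤ : ∀ (xs : List A) (f g : A → ℕ) β → (∀ x → fromℕ (g x) * β ≤ fromℕ (f x)) →
      fromℕ (∑ xs g) * β ≤ fromℕ (∑ xs f)
    ∑-scaled-≤ []       f g β h = ℚP.≤-reflexive (ℚP.*-zeroˡ β)
    ∑-scaled-≤ (x ∷ xs) f g β h = begin
      fromℕ (g x ℕ.+ ∑ xs g) * β                   ≡⟨ cong (_* β) (fromℕ-+ (g x) (∑ xs g)) ⟩
      (fromℕ (g x) + fromℕ (∑ xs g)) * β           ≡⟨ ℚP.*-distribʳ-+ β (fromℕ (g x)) _ ⟩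
      fromℕ (g x) * β + fromℕ (∑ xs g) * β         ≤⟨ ℚP.+-mono-≤ (h x) (∑-scaled-≤ xs f g β h) ⟩
      fromℕ (f x) + fromℕ (∑ xs f)                 ≡⟨ fromℕ-+ (f x) (∑ xs f) ⟨
      fromℕ (f x ℕ.+ ∑ xs f)                       ∎

    ∑-≤-+const : ∀ (xs : List A) (f g : A → ℕ) κ → (∀ x → fromℕ (f x) ≤ fromℕ (g x) + κ) →
      fromℕ (∑ xs f) ≤ fromℕ (∑ xs g) + fromℕ (length xs) * κ
    ∑-≤-+const []       f g κ h = ℚP.≤-reflexive (sym (trans (ℚP.+-identityˡ _) (ℚP.*-zeroˡ κ)))
    ∑-≤-+const (x ∷ xs) f g κ h = begin
      fromℕ (f x ℕ.+ ∑ xs f)                                   ≡⟨ fromℕ-+ (f x) (∑ xs f) ⟩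
      fromℕ (f x) + fromℕ (∑ xs f)                             ≤⟨ ℚP.+-mono-≤ (h x) (∑-≤-+const xs f g κ h) ⟩
      (a + κ) + (b + l * κ)                                    ≡⟨ solve 4 (λ a k b l → (a :+ k) :+ (b :+ l :* k) := (a :+ b) :+ (con 1ℚ :+ l) :* k) refl a κ b l ⟩
      (a + b) + (1ℚ + l) * κ                                   ≡⟨ cong₂ (λ u v → u + v * κ) (fromℕ-+ (g x) (∑ xs g)) (fromℕ-+ 1 (length xs)) ⟨
      fromℕ (g x ℕ.+ ∑ xs g) + fromℕ (suc (length xs)) * κ     ∎
      where
      a = fromℕ (g x)
      b = fromℕ (∑ xs g)
      l = fromℕ (length xs)

  /-*-inverse : ∀ (x d : ℕ) .{{_ : ℕ.NonZero d}} → ((+ x) ℚ./ d) * fromℕ d ≡ fromℕ x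
  /-*-inverse x (suc d) = ℚP.toℚᵘ-injective (begin-equality
    toℚᵘ ((+ x ℚ./ suc d) * fromℕ (suc d))       ≃⟨ ℚP.toℚᵘ-homo-* (+ x ℚ./ suc d) (fromℕ (suc d)) ⟩
    toℚᵘ (+ x ℚ./ suc d) ℚᵘ.* toℚᵘ (fromℕ (suc d)) ≃⟨ ℚᵘP.*-cong (toℚᵘ-/ (+ x) d) (toℚᵘ-fromℕ (suc d)) ⟩
    mkℚᵘ (+ x) d ℚᵘ.* mkℚᵘ (+ suc d) 0          ≃⟨ *≡* (ℤP.*-assoc (+ x) (+ suc d) (+ 1)) ⟩
    mkℚᵘ (+ x) 0                                 ≃⟨ toℚᵘ-fromℕ x ⟨
    toℚᵘ (fromℕ x)                               ∎)
    where open ℚᵘP.≤-Reasoning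

  *-nonNeg : ∀ {x y} → 0ℚ ≤ x → 0ℚ ≤ y → 0ℚ ≤ x * y
  *-nonNeg {x} {y} x≥0 y≥0 = ℚP.nonNegative⁻¹ _
    {{ℚP.nonNeg*nonNeg⇒nonNeg x {{ℚ.nonNegative x≥0}} y {{ℚ.nonNegative y≥0}}}}

  *-monoˡ-nonNeg : ∀ {r x y} → 0ℚ ≤ r → x ≤ y → r * x ≤ r * y
  *-monoˡ-nonNeg {r} r≥0 = ℚP.*-monoˡ-≤-nonNeg r {{ℚ.nonNegative r≥0}}

  *-monoʳ-nonNeg : ∀ {r x y} → 0ℚ ≤ r → x ≤ y → x * r ≤ y * r
  *-monoʳ-nonNeg {r} r≥0 = ℚP.*-monoʳ-≤-nonNeg r {{ℚ.nonNegative r≥0}}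

  ≤-+-nonNeg : ∀ {x y} → 0ℚ ≤ y → x ≤ x + y
  ≤-+-nonNeg {x} y≥0 = subst (_≤ x + _) (ℚP.+-identityʳ x) (ℚP.+-monoʳ-≤ x y≥0)

  +-cancelʳ-≤ : ∀ x y z → x + z ≤ y + z → x ≤ y
  +-cancelʳ-≤ x y z h = subst₂ _≤_ (cancel x) (cancel y) (ℚP.+-monoˡ-≤ (ℚ.- z) h)
    where
    cancel : ∀ w → w + z + ℚ.- z ≡ w
    cancel w = solve 2 (λ w z → w :+ z :+ (:- z) := w) refl w z

  below-fraction : ∀ c k v .{{_ : ℕ.NonZero v}} → ¬ (c ≤ (+ k) ℚ./ v) → fromℕ k ≤ c * fromℕ v
  below-fraction c k v k/v≱c = begin
    fromℕ k                 ≡⟨ /-*-inverse k v ⟨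
    ((+ k) ℚ./ v) * fromℕ v  ≤⟨ *-monoʳ-nonNeg (fromℕ-nonNeg v) (ℚP.<⇒≤ (ℚP.≰⇒> k/v≱c)) ⟩
    c * fromℕ v             ∎
    where open ℚP.≤-Reasoning

  2^-nonNeg : ∀ k → 0ℚ ≤ 2^- k
  2^-nonNeg k = ℚP.nonNegative⁻¹ _ {{ℚP.normalize-nonNeg 1 (2 ℕ.^ k) {{ℕP.m^n≢0 2 k}}}}

  2^-*2^ : ∀ k → 2^- k * fromℕ (2 ℕ.^ k) ≡ 1ℚ
  2^-*2^ k = /-*-inverse 1 (2 ℕ.^ k) {{ℕP.m^n≢0 2 k}}

  2^-halves : ∀ m → 2^- (suc m) + 2^- (suc m) ≡ 2^- m
  2^-halves m = begin
    h + h                                       ≡⟨ ℚP.*-identityʳ (h + h) ⟨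
    (h + h) * 1ℚ                                ≡⟨ cong ((h + h) *_) (2^-*2^ m) ⟨
    (h + h) * (2^- m * 2^m)                     ≡⟨ solve 3 (λ h a n → (h :+ h) :* (a :* n) := (h :* ((con 1ℚ :+ con 1ℚ) :* n)) :* a) refl h (2^- m) 2^m ⟩
    (h * ((1ℚ + 1ℚ) * 2^m)) * 2^- m             ≡⟨ cong (λ z → (h * z) * 2^- m) (fromℕ-* 2 (2 ℕ.^ m)) ⟨
    (h * fromℕ (2 ℕ.^ suc m)) * 2^- m           ≡⟨ cong (_* 2^- m) (2^-*2^ (suc m)) ⟩
    1ℚ * 2^- m                                  ≡⟨ ℚP.*-identityˡ (2^- m) ⟩
    2^- m                                       ∎
    where
    open ≡-Reasoning
    h = 2^- (suc m)
    2^m = fromℕ (2 ℕ.^ m)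

  2^-antitone : ∀ {k l} → k ℕ.≤ l → 2^- l ≤ 2^- k
  2^-antitone {k} {l} k≤l with ℕP.m≤n⇒∃[o]m+o≡n k≤l
  ... | o , refl = descend o
    where
    descend : ∀ o → 2^- (k ℕ.+ o) ≤ 2^- k
    descend zero    = ℚP.≤-reflexive (cong 2^-_ (ℕP.+-identityʳ k))
    descend (suc o) = ℚP.≤-trans step (descend o)
      where
      step : 2^- (k ℕ.+ suc o) ≤ 2^- (k ℕ.+ o)
      step = subst (λ j → 2^- j ≤ 2^- (k ℕ.+ o)) (sym (ℕP.+-suc k o))
               (subst (2^- suc (k ℕ.+ o) ≤_) (2^-halves (k ℕ.+ o)) (≤-+-nonNeg (2^-nonNeg (suc (k ℕ.+ o)))))

  -- The bound 2^{-k} α Y of the theorem, as a function of k = ℓ - q.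
  target : ℚ → ℚ → ℕ → ℚ
  target α Y k = 2^- k * α * Y

  module _ {α Y : ℚ} (α≥0 : 0ℚ ≤ α) (Y≥0 : 0ℚ ≤ Y) where

    target-halves : ∀ m → target α Y m ≡ target α Y (suc m) + target α Y (suc m)
    target-halves m = begin
      2^- m * α * Y                  ≡⟨ cong (λ z → z * α * Y) (2^-halves m) ⟨
      (h + h) * α * Y                ≡⟨ solve 3 (λ h a y → (h :+ h) :* a :* y := h :* a :* y :+ h :* a :* y) refl h α Y ⟩
      h * α * Y + h * α * Y          ∎
      where
      open ≡-Reasoning
      h = 2^- (suc m)

    target-antitone : ∀ {k l} → k ℕ.≤ l → target α Y l ≤ target α Y k
    target-antitone k≤l = *-monoʳ-nonNeg Y≥0 (*-monoʳ-nonNeg α≥0 (2^-antitone k≤l))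

    -- The arithmetic of the induction step: if N ≥ 1 and
    --   N · target m ≤ P · N + W · 2^{-ℓ} α N   with W ≤ Y and m < ℓ,
    -- then P ≥ target (m + 1), since 2^{-ℓ} α Y ≤ target (m + 1) = target m / 2.
    halving-step : ∀ {m ℓ} → suc m ℕ.≤ ℓ → ∀ {N} → 1 ℕ.≤ N → ∀ P W → fromℕ W ≤ Y →
      fromℕ N * target α Y m ≤ fromℕ (P ℕ.* N) + fromℕ W * (2^- ℓ * α * fromℕ N) →
      target α Y (suc m) ≤ fromℕ P
    halving-step {m} {ℓ} m<ℓ {suc N} _ P W W≤Y counted = +-cancelʳ-≤ t (fromℕ P) t (begin
      t + t                  ≡⟨ target-halves m ⟨
      target α Y m           ≤⟨ ℚP.*-cancelˡ-≤-pos n {{fromℕ-pos N}} scaled ⟩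
      fromℕ P + β * Y        ≤⟨ ℚP.+-monoʳ-≤ (fromℕ P) (target-antitone m<ℓ) ⟩
      fromℕ P + t            ∎)
      where
      open ℚP.≤-Reasoning
      t = target α Y (suc m)
      n = fromℕ (suc N)
      β = 2^- ℓ * α
      βn≥0 : 0ℚ ≤ β * n
      βn≥0 = *-nonNeg (*-nonNeg (2^-nonNeg ℓ) α≥0) (fromℕ-nonNeg (suc N))
      scaled : n * target α Y m ≤ n * (fromℕ P + β * Y)
      scaled = begin
        n * target α Y m                        ≤⟨ counted ⟩
        fromℕ (P ℕ.* suc N) + fromℕ W * (β * n) ≤⟨ ℚP.+-monoʳ-≤ (fromℕ (P ℕ.* suc N)) (*-monoʳ-nonNeg βn≥0 W≤Y) ⟩
        fromℕ (P ℕ.* suc N) + Y * (β * n)       ≡⟨ cong (_+ Y * (β * n)) (fromℕ-* P (suc N)) ⟩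
        fromℕ P * n + Y * (β * n)               ≡⟨ solve 4 (λ p n y b → p :* n :+ y :* (b :* n) := n :* (p :+ b :* y)) refl (fromℕ P) n Y β ⟩
        n * (fromℕ P + β * Y)                   ∎

module EdgeSets where

  open import Defs hiding (sym)
  open FiniteSums
  open import Data.Bool using (Bool; true; false; _∧_)
  import Data.Bool.Properties as BoolP
  open import Data.Nat as ℕ using (ℕ; zero; suc; _+_; _*_; _≤_; _<ᵇ_; _⊓_)
  import Data.Nat.Properties as ℕP
  open import Data.Nat.ListAction using (sum)
  open import Data.Fin using (Fin; toℕ)
  import Data.Fin.Properties as FinP
  open import Data.List using (List; []; _∷_; map; filter; foldr; length; allFin; cartesianProduct)
  open import Data.List.Relation.Unary.All as All using (All; []; _∷_)
  open import Data.Product using (_×_; _,_; proj₁; uncurry)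
  open import Function using (_∘_; Equivalence)
  open import Data.Empty using (⊥-elim)
  open import Relation.Nullary using (ofʸ; ofⁿ)
  open import Relation.Binary.PropositionalEquality

  private
    variable
      n : ℕ

  Simple : EdgeSet n → Set
  Simple D = (∀ x y → D x y ≡ D y x) × (∀ x → D x x ≡ false)

  EdgeSetIn⇒Simple : ∀ (G : Graph n) {X D} → EdgeSetIn G X D → Simple D
  EdgeSetIn⇒Simple G {D = D} (D-sym , D⊆G) = D-sym , loopless
    where
    loopless : ∀ x → D x x ≡ false
    loopless x with D x x in eq
    ... | false = refl
    ... | true  with () ← trans (sym (proj₁ (D⊆G x x eq))) (Graph.irrefl G x)

  -- The pair (x , y) lists the edge xy of D when x < y, so that every edge is
  -- listed exactly once; |D| is the number of listed pairs.
  listed : EdgeSet n → Fin n → Fin n → Bool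
  listed D x y = D x y ∧ (toℕ x <ᵇ toℕ y)

  listed⇒ : ∀ (D : EdgeSet n) x y → listed D x y ≡ true → D x y ≡ true × toℕ x ℕ.< toℕ y
  listed⇒ D x y xy-listed with D x y
  ... | true = refl , ℕP.<ᵇ⇒< (toℕ x) (toℕ y) (Equivalence.from BoolP.T-≡ xy-listed)

  ⇒listed : ∀ (D : EdgeSet n) x y → D x y ≡ true → toℕ x ℕ.< toℕ y → listed D x y ≡ true
  ⇒listed D x y xy∈D x<y rewrite xy∈D = Equivalence.to BoolP.T-≡ (ℕP.<⇒<ᵇ x<y)

  numEdges-∑ : (D : EdgeSet n) → numEdges D ≡ ∑[ x ∈ allFin n ] ∑[ y ∈ allFin n ] 𝟙 (listed D x y)
  numEdges-∑ {n} D = ∑-cong (allFin n) (λ x → ∣tabulate∣ n (listed D x))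

  pairs : ∀ n → List (Fin n × Fin n)
  pairs n = cartesianProduct (allFin n) (allFin n)

  numEdges-pairs : (D : EdgeSet n) → numEdges D ≡ ∑[ p ∈ pairs n ] 𝟙 (uncurry (listed D) p)
  numEdges-pairs {n} D = trans (numEdges-∑ D) (sym (∑-cartesianProduct (allFin n) (allFin n) (𝟙 ∘ uncurry (listed D))))

  numEdges-mono : ∀ (B D : EdgeSet n) → (∀ x y → B x y ≡ true → D x y ≡ true) → numEdges B ≤ numEdges D
  numEdges-mono {n} B D B⊆D = subst₂ _≤_ (sym (numEdges-∑ B)) (sym (numEdges-∑ D))
    (∑-mono (allFin n) (λ {x} _ → ∑-mono (allFin n) (λ {y} _ → 𝟙-mono (listed-mono x y))))
    where
    listed-mono : ∀ x y → listed B x y ≡ true → listed D x y ≡ true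
    listed-mono x y listed-B with B x y in Bxy
    ... | true rewrite B⊆D x y Bxy = listed-B

  𝟙-split : ∀ {D : EdgeSet n} → Simple D → ∀ x y → 𝟙 (D x y) ≡ 𝟙 (listed D x y) + 𝟙 (listed D y x)
  𝟙-split {D = D} (D-sym , loopless) x y
    with toℕ x <ᵇ toℕ y | ℕP.<ᵇ-reflects-< (toℕ x) (toℕ y) | toℕ y <ᵇ toℕ x | ℕP.<ᵇ-reflects-< (toℕ y) (toℕ x)
  ... | true  | ofʸ x<y | true  | ofʸ y<x = ⊥-elim (ℕP.<-asym x<y y<x)
  ... | true  | _       | false | _       rewrite BoolP.∧-identityʳ (D x y) | BoolP.∧-zeroʳ (D y x) =
    sym (ℕP.+-identityʳ _)
  ... | false | _       | true  | _       rewrite BoolP.∧-identityʳ (D y x) | BoolP.∧-zeroʳ (D x y) =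
    cong 𝟙 (D-sym x y)
  ... | false | ofⁿ x≮y | false | ofⁿ y≮x rewrite BoolP.∧-zeroʳ (D x y) | BoolP.∧-zeroʳ (D y x) =
    cong 𝟙 (trans (cong (D x) (sym x≡y)) (loopless x))
    where
    x≡y : x ≡ y
    x≡y = FinP.toℕ-injective (ℕP.≤-antisym (ℕP.≮⇒≥ y≮x) (ℕP.≮⇒≥ x≮y))

  handshake : ∀ {D : EdgeSet n} → Simple D → ∑ (allFin n) (deg D) ≡ 2 * numEdges D
  handshake {n} {D} simple = begin
    ∑[ x ∈ Fn ] deg D x                                                  ≡⟨ ∑-cong Fn (λ x → ∣tabulate∣ n (D x)) ⟩
    ∑[ x ∈ Fn ] ∑[ y ∈ Fn ] 𝟙 (D x y)                                    ≡⟨ ∑-cong Fn (λ x → ∑-cong Fn (𝟙-split simple x)) ⟩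
    ∑[ x ∈ Fn ] ∑[ y ∈ Fn ] (𝟙 (listed D x y) + 𝟙 (listed D y x))         ≡⟨ ∑-cong Fn (λ x → ∑-distrib-+ Fn _ _) ⟩
    ∑[ x ∈ Fn ] (∑[ y ∈ Fn ] 𝟙 (listed D x y) + ∑[ y ∈ Fn ] 𝟙 (listed D y x)) ≡⟨ ∑-distrib-+ Fn _ _ ⟩
    E + ∑[ x ∈ Fn ] ∑[ y ∈ Fn ] 𝟙 (listed D y x)                         ≡⟨ cong (E +_) (∑-swap Fn Fn (λ x y → 𝟙 (listed D y x))) ⟩
    E + E                                                                ≡⟨ cong (E +_) (ℕP.+-identityʳ E) ⟨
    E + (E + 0)                                                          ≡⟨ cong (λ e → e + (e + 0)) (numEdges-∑ D) ⟨
    2 * numEdges D                                                       ∎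
    where
    open ≡-Reasoning
    Fn = allFin n
    E = ∑[ x ∈ Fn ] ∑[ y ∈ Fn ] 𝟙 (listed D x y)

  sum-degreesOf : (D : EdgeSet n) → sum (degreesOf D) ≡ ∑ (allFin n) (deg D)
  sum-degreesOf {n} D = drop-zeros (map (deg D) (allFin n))
    where
    drop-zeros : ∀ ds → sum (filter (1 ℕ.≤?_) ds) ≡ sum ds
    drop-zeros []           = refl
    drop-zeros (zero  ∷ ds) = drop-zeros ds
    drop-zeros (suc d ∷ ds) = cong (suc d +_) (drop-zeros ds)

  δ-lowerBound : (D : EdgeSet n) → All (δ D ≤_) (degreesOf D)
  δ-lowerBound D with degreesOf D
  ... | []     = []
  ... | d ∷ ds = foldr-⊓-bound d ds
    where
    foldr-⊓-bound : ∀ d ds → All (foldr _⊓_ d ds ≤_) (d ∷ ds)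
    foldr-⊓-bound d []       = ℕP.≤-refl ∷ []
    foldr-⊓-bound d (e ∷ es) with foldr-⊓-bound d es
    ... | d-bound ∷ es-bound = ℕP.≤-trans (ℕP.m⊓n≤n e _) d-bound ∷ ℕP.m⊓n≤m e _
                             ∷ All.map (ℕP.≤-trans (ℕP.m⊓n≤n e _)) es-bound

  δ*numVertices≤2*numEdges : ∀ {D : EdgeSet n} → Simple D → δ D * numVertices D ≤ 2 * numEdges D
  δ*numVertices≤2*numEdges {D = D} simple = begin
    δ D * length (degreesOf D)  ≤⟨ lower-sum (δ D) (degreesOf D) (δ-lowerBound D) ⟩
    sum (degreesOf D)           ≡⟨ trans (sum-degreesOf D) (handshake simple) ⟩
    2 * numEdges D              ∎
    where
    open ℕP.≤-Reasoning
    lower-sum : ∀ m ds → All (m ≤_) ds → m * length ds ≤ sum ds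
    lower-sum m []       []         = ℕP.≤-reflexive (ℕP.*-zeroʳ m)
    lower-sum m (d ∷ ds) (m≤d ∷ ms) = ℕP.≤-trans (ℕP.≤-reflexive (ℕP.*-suc m (length ds)))
                                                 (ℕP.+-mono-≤ m≤d (lower-sum m ds ms))

  numVertices≡0⇒numEdges≡0 : ∀ {D : EdgeSet n} → Simple D → numVertices D ≡ 0 → numEdges D ≡ 0
  numVertices≡0⇒numEdges≡0 {n} {D} simple v≡0 =
    ℕP.*-cancelˡ-≡ (numEdges D) 0 2 (trans (sym (handshake simple)) (trans (sym (sum-degreesOf D)) (empty (degreesOf D) v≡0)))
    where
    empty : ∀ ds → length ds ≡ 0 → sum ds ≡ 0
    empty [] _ = refl

  numVertices-pos : (D : EdgeSet n) → 1 ≤ δ D → 1 ≤ numVertices D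
  numVertices-pos D δ≥1 with degreesOf D
  ... | []    = δ≥1
  ... | _ ∷ _ = ℕ.s≤s ℕ.z≤n

  numVertices-mono : ∀ (B D : EdgeSet n) → (∀ x y → B x y ≡ true → D x y ≡ true) →
    numVertices B ≤ numVertices D
  numVertices-mono {n} B D B⊆D = positives-mono (allFin n) degB≤degD
    where
    degB≤degD : ∀ x → deg B x ≤ deg D x
    degB≤degD x = subst₂ _≤_ (sym (∣tabulate∣ n (B x))) (sym (∣tabulate∣ n (D x)))
                    (∑-mono (allFin n) (λ {y} _ → 𝟙-mono (B⊆D x y)))
    positives-mono : ∀ xs {f g : Fin n → ℕ} → (∀ x → f x ≤ g x) →
      length (filter (1 ℕ.≤?_) (map f xs)) ≤ length (filter (1 ℕ.≤?_) (map g xs))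
    positives-mono []       f≤g = ℕ.z≤n
    positives-mono (x ∷ xs) {f} {g} f≤g with f x | g x | f≤g x
    ... | zero  | zero  | _ = positives-mono xs f≤g
    ... | zero  | suc _ | _ = ℕP.m≤n⇒m≤1+n (positives-mono xs f≤g)
    ... | suc _ | suc _ | _ = ℕ.s≤s (positives-mono xs f≤g)

module AverageDegree where

  open import Defs hiding (sym)
  open Rationals
  open EdgeSets
  open import Data.Bool using (true)
  open import Data.Nat as ℕ using (ℕ; zero; suc)
  open import Data.Integer using (+_)
  open import Data.Rational using (ℚ; 0ℚ; _/_; _*_; _≤_; _<_)
  import Data.Rational.Properties as ℚP
  open import Data.Rational.Solver using (module +-*-Solver)
  open +-*-Solver using (solve; _:=_; _:*_)
  open import Data.Product using (_,_; proj₁; proj₂)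
  open import Data.Empty using (⊥-elim)
  open import Function using (_∘_)
  open import Relation.Nullary using (¬_; Dec; yes; no)
  import Relation.Nullary.Decidable as Dec
  open import Relation.Binary.PropositionalEquality

  private
    variable
      n : ℕ

  AvgDegAtLeast? : (B : EdgeSet n) (c : ℚ) → Dec (AvgDegAtLeast B c)
  AvgDegAtLeast? B c = decide (1 ℕ.≤? numVertices B)
    where
    decide : Dec (1 ℕ.≤ numVertices B) → Dec (AvgDegAtLeast B c)
    decide (yes v≥1) = Dec.map′ (v≥1 ,_) proj₂
      (c ℚP.≤? ((+ (2 ℕ.* numEdges B)) / numVertices B) {{ℕ.>-nonZero v≥1}})
    decide (no v≱1) = no (v≱1 ∘ proj₁)

  below-average : ∀ {B : EdgeSet n} {c} → Simple B → ¬ AvgDegAtLeast B c →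
    fromℕ (2 ℕ.* numEdges B) ≤ c * fromℕ (numVertices B)
  below-average {B = B} {c} simple below with numVertices B in v-eq
  ... | zero  rewrite numVertices≡0⇒numEdges≡0 simple v-eq = ℚP.≤-reflexive (sym (ℚP.*-zeroʳ c))
  ... | suc v = below-fraction c (2 ℕ.* numEdges B) (suc v)
                  (λ c≤avg → below (ℕ.s≤s ℕ.z≤n , c≤avg))

  minDegree-bound : ∀ {D : EdgeSet n} {C} → Simple D → C < fromℕ (δ D) →
    C * fromℕ (numVertices D) ≤ fromℕ (2 ℕ.* numEdges D)
  minDegree-bound {D = D} {C} simple C<δ = begin
    C * fromℕ (numVertices D)        ≤⟨ *-monoʳ-nonNeg (fromℕ-nonNeg (numVertices D)) (ℚP.<⇒≤ C<δ) ⟩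
    fromℕ (δ D) * fromℕ (numVertices D) ≡⟨ fromℕ-* (δ D) (numVertices D) ⟨
    fromℕ (δ D ℕ.* numVertices D)    ≤⟨ fromℕ-mono (δ*numVertices≤2*numEdges simple) ⟩
    fromℕ (2 ℕ.* numEdges D)         ∎
    where open ℚP.≤-Reasoning

  minDegree-edge : ∀ {D : EdgeSet n} {C} → Simple D → 0ℚ ≤ C → C < fromℕ (δ D) → 1 ℕ.≤ numEdges D
  minDegree-edge {D = D} {C} simple C≥0 C<δ =
    positive-product (δ D) (numVertices D) (numEdges D) δ≥1 (numVertices-pos D δ≥1) (δ*numVertices≤2*numEdges simple)
    where
    positive : ∀ d → C < fromℕ d → 1 ℕ.≤ d
    positive zero    C<0 = ⊥-elim (ℚP.<-irrefl refl (ℚP.≤-<-trans C≥0 C<0))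
    positive (suc _) _   = ℕ.s≤s ℕ.z≤n
    δ≥1 : 1 ℕ.≤ δ D
    δ≥1 = positive (δ D) C<δ
    positive-product : ∀ a b e → 1 ℕ.≤ a → 1 ℕ.≤ b → a ℕ.* b ℕ.≤ 2 ℕ.* e → 1 ℕ.≤ e
    positive-product (suc a) (suc b) zero    _ _ ()
    positive-product a       b       (suc e) _ _ _ = ℕ.s≤s ℕ.z≤n

  sparse-part : ∀ {B D : EdgeSet n} {β C} → 0ℚ ≤ β → 0ℚ ≤ C → Simple B →
    (∀ x y → B x y ≡ true → D x y ≡ true) → C * fromℕ (numVertices D) ≤ fromℕ (2 ℕ.* numEdges D) →
    ¬ AvgDegAtLeast B (β * C) → fromℕ (numEdges B) ≤ β * fromℕ (numEdges D)
  sparse-part {B = B} {D} {β} {C} β≥0 C≥0 simple B⊆D dense sparse = ℚP.*-cancelˡ-≤-pos (fromℕ 2) {{fromℕ-pos 1}} (begin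
    fromℕ 2 * fromℕ (numEdges B)          ≡⟨ fromℕ-* 2 (numEdges B) ⟨
    fromℕ (2 ℕ.* numEdges B)              ≤⟨ below-average simple sparse ⟩
    β * C * fromℕ (numVertices B)         ≤⟨ *-monoˡ-nonNeg (*-nonNeg β≥0 C≥0) (fromℕ-mono (numVertices-mono B D B⊆D)) ⟩
    β * C * fromℕ (numVertices D)         ≡⟨ ℚP.*-assoc β C _ ⟩
    β * (C * fromℕ (numVertices D))       ≤⟨ *-monoˡ-nonNeg β≥0 dense ⟩
    β * fromℕ (2 ℕ.* numEdges D)          ≡⟨ cong (β *_) (fromℕ-* 2 (numEdges D)) ⟩
    β * (fromℕ 2 * fromℕ (numEdges D))    ≡⟨ solve 3 (λ b t e → b :* (t :* e) := t :* (b :* e)) refl β (fromℕ 2) (fromℕ (numEdges D)) ⟩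
    fromℕ 2 * (β * fromℕ (numEdges D))    ∎)
    where open ℚP.≤-Reasoning

module Lists where

  open FiniteSums
  open import Data.Nat as ℕ using (ℕ; zero; suc; _+_; _*_; _^_; _≤_)
  import Data.Nat.Properties as ℕP
  open import Data.Fin as Fin using (Fin)
  import Data.Fin.Properties as FinP
  open import Data.List using (List; []; _∷_; [_]; _++_; map; concat; length; lookup; filter; deduplicate)
  import Data.List.Properties as ListP
  open import Data.List.Relation.Unary.All as All using (All; []; _∷_)
  import Data.List.Relation.Unary.All.Properties as AllP
  open import Data.List.Relation.Unary.Any as Any using (here; there)
  import Data.List.Relation.Unary.Any.Properties as AnyP
  open import Data.List.Relation.Unary.AllPairs using (_∷_)
  open import Data.List.Membership.Propositional using () renaming (_∈_ to _∈ₚ_)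
  import Data.List.Membership.Propositional.Properties as PropMembershipP
  import Data.List.Membership.Setoid as SetoidMembership
  import Data.List.Membership.Setoid.Properties as SetoidMembershipP
  import Data.List.Membership.DecSetoid as DecSetoidMembership
  import Data.List.Relation.Unary.Unique.Setoid as SetoidUnique
  import Data.List.Relation.Unary.Unique.DecSetoid.Properties as DecSetoidUniqueP
  open import Relation.Binary.Bundles using (Setoid; DecSetoid)
  open import Relation.Binary.Properties.Setoid using (respʳ-flip)
  open import Relation.Nullary using (does)
  open import Data.Empty using (⊥-elim)
  open import Function using (_∘_)
  open import Level using (0ℓ)
  open import Data.Product using (_×_; _,_; proj₁; proj₂; map₁)
  open import Relation.Binary.PropositionalEquality using (_≡_; refl; cong; cong₂; trans)

  module Pigeonhole {a ℓ} (S : Setoid a ℓ) where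
    open Setoid S using (_≈_) renaming (sym to ≈-sym)
    open SetoidMembership S using (_∈_)
    open SetoidUnique S using (Unique)

    lookup-injective : ∀ {xs} → Unique xs → ∀ i j → lookup xs i ≈ lookup xs j → i ≡ j
    lookup-injective (x≉ ∷ u) Fin.zero    Fin.zero    _   = refl
    lookup-injective (x≉ ∷ u) Fin.zero    (Fin.suc j) x≈  = ⊥-elim (All.lookup x≉ (PropMembershipP.∈-lookup j) x≈)
    lookup-injective (x≉ ∷ u) (Fin.suc i) Fin.zero    ≈x  = ⊥-elim (All.lookup x≉ (PropMembershipP.∈-lookup i) (≈-sym ≈x))
    lookup-injective (x≉ ∷ u) (Fin.suc i) (Fin.suc j) eq  = cong Fin.suc (lookup-injective u i j eq)

    unique-length-≤ : ∀ {xs ys} → Unique xs → All (_∈ ys) xs → length xs ≤ length ys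
    unique-length-≤ {xs} {ys} unique xs⊆ys = FinP.injective⇒≤ position-injective
      where
      membership : ∀ i → lookup xs i ∈ ys
      membership i = All.lookup xs⊆ys (PropMembershipP.∈-lookup i)
      position : Fin (length xs) → Fin (length ys)
      position i = Any.index (membership i)
      position-injective : ∀ {i j} → position i ≡ position j → i ≡ j
      position-injective {i} {j} same = lookup-injective unique i j (begin
        lookup xs i                ≈⟨ AnyP.lookup-index (membership i) ⟩
        lookup ys (position i)     ≡⟨ cong (lookup ys) same ⟩
        lookup ys (position j)     ≈⟨ AnyP.lookup-index (membership j) ⟨
        lookup xs j                ∎)
        where open import Relation.Binary.Reasoning.Setoid S

  private
    variable
      A : Set

  ++-injective : ∀ {xs ys xs′ ys′ : List A} → length xs ≡ length xs′ →
    xs ++ ys ≡ xs′ ++ ys′ → xs ≡ xs′ × ys ≡ ys′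
  ++-injective {xs = []}     {xs′ = []}     _   same = refl , same
  ++-injective {xs = x ∷ xs} {xs′ = y ∷ xs′} len same with ListP.∷-injective same
  ... | refl , same′ = map₁ (cong (x ∷_)) (++-injective (ℕP.suc-injective len) same′)

  map-≡⇒≗ : ∀ {B : Set} {f g : A → B} {x} (xs : List A) → map f xs ≡ map g xs → x ∈ₚ xs → f x ≡ g x
  map-≡⇒≗ (y ∷ xs) same (here refl) = proj₁ (ListP.∷-injective same)
  map-≡⇒≗ (y ∷ xs) same (there x∈)  = map-≡⇒≗ xs (proj₂ (ListP.∷-injective same)) x∈

  prependEach : List A → List (List A) → List (List A)
  prependEach []       ts = []
  prependEach (x ∷ xs) ts = map (x ∷_) ts ++ prependEach xs ts

  tuples : ℕ → List A → List (List A)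
  tuples zero    xs = [ [] ]
  tuples (suc k) xs = prependEach xs (tuples k xs)

  length-prependEach : ∀ (xs : List A) ts → length (prependEach xs ts) ≡ length xs * length ts
  length-prependEach []       ts = refl
  length-prependEach (x ∷ xs) ts = trans (ListP.length-++ (map (x ∷_) ts))
    (cong₂ _+_ (ListP.length-map (x ∷_) ts) (length-prependEach xs ts))

  ∈-prependEach : ∀ {x t} (xs : List A) ts → x ∈ₚ xs → t ∈ₚ ts → (x ∷ t) ∈ₚ prependEach xs ts
  ∈-prependEach (x ∷ xs) ts (here refl) t∈ = PropMembershipP.∈-++⁺ˡ (PropMembershipP.∈-map⁺ (x ∷_) t∈)
  ∈-prependEach (y ∷ xs) ts (there x∈) t∈ = PropMembershipP.∈-++⁺ʳ (map (y ∷_) ts) (∈-prependEach xs ts x∈ t∈)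

  length-tuples : ∀ k (xs : List A) → length (tuples k xs) ≡ length xs ^ k
  length-tuples zero    xs = refl
  length-tuples (suc k) xs = trans (length-prependEach xs (tuples k xs)) (cong (length xs *_) (length-tuples k xs))

  ∈-tuples : ∀ k (xs ys : List A) → length ys ≡ k → All (_∈ₚ xs) ys → ys ∈ₚ tuples k xs
  ∈-tuples zero    xs []       refl []         = here refl
  ∈-tuples (suc k) xs (y ∷ ys) refl (y∈ ∷ ys⊆) = ∈-prependEach xs (tuples k xs) y∈ (∈-tuples k xs ys refl ys⊆)

  module DoubleCounting (DS : DecSetoid 0ℓ 0ℓ) where
    open DecSetoid DS using (_≟_; setoid) renaming (Carrier to Elem; refl to ≈-refl)
    open SetoidMembership setoid using (_∈_)
    open SetoidMembershipP using (∈-resp-≈; ∈-deduplicate⁺; ∈-concat⁺; ∈-filter⁺)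
    open DecSetoidMembership DS using (_∈?_)
    open SetoidUnique setoid using (Unique)
    open Pigeonhole setoid using (unique-length-≤)

    module _ {I : Set} (ps : List I) (L : I → List Elem) where

      gathered : List Elem
      gathered = deduplicate _≟_ (concat (map L ps))

      gathered-unique : Unique gathered
      gathered-unique = DecSetoidUniqueP.deduplicate-! DS (concat (map L ps))

      gathered-all : ∀ {p} {P : Elem → Set p} → All (All P ∘ L) ps → All P gathered
      gathered-all all-P = AllP.deduplicate⁺ _≟_ (AllP.concat⁺ (AllP.map⁺ all-P))

      multiplicity : Elem → ℕ
      multiplicity w = ∑[ p ∈ ps ] 𝟙 (does (w ∈? L p))

      ∈-gathered : ∀ {x p} → p ∈ₚ ps → x ∈ L p → x ∈ gathered
      ∈-gathered p∈ps x∈Lp = ∈-deduplicate⁺ setoid _≟_ (respʳ-flip setoid)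
        (∈-concat⁺ setoid (AnyP.map⁺ (Any.map (λ { refl → x∈Lp }) p∈ps)))

      double-counting : All (Unique ∘ L) ps → ∑[ p ∈ ps ] length (L p) ≤ ∑[ w ∈ gathered ] multiplicity w
      double-counting unique = begin
        ∑[ p ∈ ps ] length (L p)                                    ≤⟨ ∑-mono ps (λ p∈ps → unique-length-≤ (All.lookup unique p∈ps) (covered p∈ps)) ⟩
        ∑[ p ∈ ps ] length (filter (_∈? L p) gathered)              ≡⟨ ∑-cong ps (λ p → length-filter (_∈? L p) gathered) ⟩
        ∑[ p ∈ ps ] ∑[ w ∈ gathered ] 𝟙 (does (w ∈? L p))           ≡⟨ ∑-swap ps gathered (λ p w → 𝟙 (does (w ∈? L p))) ⟩
        ∑[ w ∈ gathered ] multiplicity w                            ∎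
        where
        open ℕP.≤-Reasoning
        covered : ∀ {p} → p ∈ₚ ps → All (_∈ filter (_∈? L p) gathered) (L p)
        covered {p} p∈ps = All.tabulate λ x∈ → let x∈Lp = Any.map (λ { refl → ≈-refl }) x∈ in
          ∈-filter⁺ setoid (_∈? L p) (∈-resp-≈ setoid) (∈-gathered p∈ps x∈Lp) x∈Lp

module Subsets where

  open FiniteSums
  open import Data.Bool as Bool using (true; false)
  open import Data.Nat using (zero; suc; _+_; _^_)
  import Data.Nat.Properties as ℕP
  open import Data.Fin as Fin using (Fin)
  open import Data.Fin.Subset as Subset using (Subset; inside; outside; ∣_∣)
  open import Data.Fin.Subset.Properties as SubsetP using (_∈?_)
  open import Data.Vec as Vec using (_∷_)
  import Data.Vec.Properties as VecP
  open import Data.List using (List; [_]; _++_; map; length; allFin; filter)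
  import Data.List.Properties as ListP
  open import Data.List.Relation.Unary.All as All using ()
  open import Data.List.Relation.Unary.Any using (here)
  open import Data.List.Membership.Propositional using () renaming (_∈_ to _∈ₚ_)
  import Data.List.Membership.Propositional.Properties as PropMembershipP
  open import Data.Product using (proj₂)
  open import Function using (_∘_)
  open import Relation.Nullary using (Dec; does)
  open import Relation.Nullary.Decidable using (map′)
  open import Relation.Binary.PropositionalEquality hiding ([_])

  allSubsets : ∀ k → List (Subset k)
  allSubsets zero    = [ Vec.[] ]
  allSubsets (suc k) = map (inside ∷_) (allSubsets k) ++ map (outside ∷_) (allSubsets k)

  length-allSubsets : ∀ k → length (allSubsets k) ≡ 2 ^ k
  length-allSubsets zero    = refl
  length-allSubsets (suc k) = begin
    length (map (inside ∷_) (allSubsets k) ++ map (outside ∷_) (allSubsets k))  ≡⟨ ListP.length-++ (map (inside ∷_) (allSubsets k)) ⟩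
    length (map (inside ∷_) (allSubsets k)) + length (map (outside ∷_) (allSubsets k))
      ≡⟨ cong₂ _+_ (ListP.length-map _ (allSubsets k)) (ListP.length-map _ (allSubsets k)) ⟩
    length (allSubsets k) + length (allSubsets k)                               ≡⟨ cong (λ m → m + m) (length-allSubsets k) ⟩
    2 ^ k + 2 ^ k                                                               ≡⟨ cong (2 ^ k +_) (ℕP.+-identityʳ (2 ^ k)) ⟨
    2 ^ suc k                                                                   ∎
    where open ≡-Reasoning

  ∈-allSubsets : ∀ {k} (I : Subset k) → I ∈ₚ allSubsets k
  ∈-allSubsets Vec.[] = here refl
  ∈-allSubsets {suc k} (true ∷ I)  = PropMembershipP.∈-++⁺ˡ (PropMembershipP.∈-map⁺ (inside ∷_) (∈-allSubsets I))
  ∈-allSubsets {suc k} (false ∷ I) = PropMembershipP.∈-++⁺ʳ (map (inside ∷_) (allSubsets k))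
                                       (PropMembershipP.∈-map⁺ (outside ∷_) (∈-allSubsets I))

  ∀-subset? : ∀ {k} {P : Subset k → Set} → (∀ I → Dec (P I)) → Dec (∀ I → P I)
  ∀-subset? {k} P? = map′ (λ all I → All.lookup all (∈-allSubsets I)) (λ all → All.tabulate (λ {I} _ → all I))
                          (All.all? P? (allSubsets k))

  _≟ₛ_ : ∀ {k} (A B : Subset k) → Dec (A ≡ B)
  _≟ₛ_ = VecP.≡-dec Bool._≟_

  members : ∀ {n} → Subset n → List (Fin n)
  members {n} A = filter (_∈? A) (allFin n)

  ∈-members : ∀ {n} {x : Fin n} {A} → x Subset.∈ A → x ∈ₚ members A
  ∈-members {x = x} x∈A = PropMembershipP.∈-filter⁺ (_∈? _) (PropMembershipP.∈-allFin x) x∈A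

  members-∈ : ∀ {n} {x : Fin n} {A} → x ∈ₚ members A → x Subset.∈ A
  members-∈ {n} {A = A} = proj₂ ∘ PropMembershipP.∈-filter⁻ (_∈? A) {xs = allFin n}

  members-injective : ∀ {n} {A B : Subset n} → members A ≡ members B → A ≡ B
  members-injective {A = A} {B} same = SubsetP.⊆-antisym
    (λ x∈A → members-∈ (subst (_ ∈ₚ_) same (∈-members x∈A)))
    (λ x∈B → members-∈ (subst (_ ∈ₚ_) (sym same) (∈-members x∈B)))

  length-members : ∀ {n} (A : Subset n) → length (members A) ≡ ∣ A ∣
  length-members {n} A = begin
    length (filter (_∈? A) (allFin n))         ≡⟨ length-filter (_∈? A) (allFin n) ⟩
    ∑[ x ∈ allFin n ] 𝟙 (does (x ∈? A))        ≡⟨ ∑-cong (allFin n) (cong 𝟙 ∘ does-∈? A) ⟩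
    ∑[ x ∈ allFin n ] 𝟙 (Vec.lookup A x)       ≡⟨ ∣tabulate∣ n (Vec.lookup A) ⟨
    ∣ Vec.tabulate (Vec.lookup A) ∣            ≡⟨ cong ∣_∣ (VecP.tabulate∘lookup A) ⟩
    ∣ A ∣                                      ∎
    where
    open ≡-Reasoning
    does-∈? : ∀ {k} (A : Subset k) x → does (x ∈? A) ≡ Vec.lookup A x
    does-∈? (true  ∷ A) Fin.zero    = refl
    does-∈? (false ∷ A) Fin.zero    = refl
    does-∈? (_     ∷ A) (Fin.suc x) = does-∈? A x

module Configurations where

  open import Defs hiding (sym)
  open Lists
  open Subsets
  open import Data.Nat using (ℕ; _+_; _*_; _^_; _∸_; _≤_)
  import Data.Nat.Properties as ℕP
  open import Data.Fin using (Fin)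
  import Data.Fin.Properties as FinP
  open import Data.Fin.Subset using (Subset; _⊆_; ∣_∣)
  import Data.Fin.Subset.Properties as SubsetP
  open import Data.List using (List; _++_; map; length; allFin)
  import Data.List.Properties as ListP
  open import Data.List.Relation.Unary.All as All using (All)
  import Data.List.Relation.Unary.All.Properties as AllP
  open import Data.List.Relation.Unary.AllPairs as AllPairs using (AllPairs)
  import Data.List.Relation.Unary.AllPairs.Properties as AllPairsP
  open import Data.List.Membership.Propositional using () renaming (_∈_ to _∈ₚ_)
  import Data.List.Membership.Propositional.Properties as PropMembershipP
  open import Data.Product using (_×_; _,_; proj₁; proj₂)
  open import Data.Sum using (inj₁; inj₂)
  open import Data.Empty using (⊥-elim)
  open import Relation.Nullary using (¬_; Dec; yes; no; ¬?; _⊎-dec_)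
  open import Relation.Nullary.Decidable using (decidable-stable)
  open import Relation.Binary.Bundles using (DecSetoid)
  import Relation.Binary.Construct.On as On
  open import Level using (0ℓ)
  import Data.Rational as ℚ
  import Data.Rational.Properties as ℚP
  open import Relation.Binary.PropositionalEquality
  open import Relation.Binary.PropositionalEquality.Properties using (setoid) renaming (decSetoid to ≡-decSetoid)

  module _ {r ℓ n : ℕ} where

    parts : Zfun r ℓ n → List (Subset n)
    parts S = map (SI S) (allSubsets ℓ) ++ map (S' S) (allFin (r ∸ 3))

    Equivalence : DecSetoid 0ℓ 0ℓ
    Equivalence = On.decSetoid (≡-decSetoid (ListP.≡-dec _≟ₛ_)) parts

    _≈_ : Zfun r ℓ n → Zfun r ℓ n → Set
    S ≈ T = parts S ≡ parts T

    ≈⇒same-parts : ∀ {S T : Zfun r ℓ n} → S ≈ T → (∀ I → SI S I ≡ SI T I) × (∀ j → S' S j ≡ S' T j)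
    ≈⇒same-parts {S} {T} S≈T with ++-injective (trans (ListP.length-map (SI S) (allSubsets ℓ))
                                                       (sym (ListP.length-map (SI T) (allSubsets ℓ)))) S≈T
    ... | same-SI , same-S' = (λ I → map-≡⇒≗ (allSubsets ℓ) same-SI (∈-allSubsets I))
                            , (λ j → map-≡⇒≗ (allFin (r ∸ 3)) same-S' (PropMembershipP.∈-allFin j))

    Distinct⇒≉ : ∀ {S T : Zfun r ℓ n} → Distinct S T → ¬ S ≈ T
    Distinct⇒≉ (inj₁ (I , differ)) S≈T = differ (proj₁ (≈⇒same-parts S≈T) I)
    Distinct⇒≉ (inj₂ (j , differ)) S≈T = differ (proj₂ (≈⇒same-parts S≈T) j)

    -- Distinctness is decidable, hence implied by inequivalence.
    Distinct? : ∀ (S T : Zfun r ℓ n) → Dec (Distinct S T)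
    Distinct? S T = SubsetP.anySubset? (λ I → ¬? (SI S I ≟ₛ SI T I)) ⊎-dec FinP.any? (λ j → ¬? (S' S j ≟ₛ S' T j))

    ≉⇒Distinct : ∀ {S T : Zfun r ℓ n} → ¬ S ≈ T → Distinct S T
    ≉⇒Distinct {S} {T} S≉T with Distinct? S T
    ... | yes distinct = distinct
    ... | no  same     =
      ⊥-elim (S≉T (cong₂ _++_ (ListP.map-cong same-SI (allSubsets ℓ)) (ListP.map-cong same-S' (allFin (r ∸ 3)))))
      where
      same-SI : ∀ I → SI S I ≡ SI T I
      same-SI I = decidable-stable (SI S I ≟ₛ SI T I) (λ differ → same (inj₁ (I , differ)))
      same-S' : ∀ j → S' S j ≡ S' T j
      same-S' j = decidable-stable (S' S j ≟ₛ S' T j) (λ differ → same (inj₂ (j , differ)))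

    length-parts : ∀ S → length (parts S) ≡ 2 ^ ℓ + (r ∸ 3)
    length-parts S = trans (ListP.length-++ (map (SI S) (allSubsets ℓ)))
      (cong₂ _+_ (trans (ListP.length-map (SI S) (allSubsets ℓ)) (length-allSubsets ℓ))
                 (trans (ListP.length-map (S' S) (allFin (r ∸ 3))) (ListP.length-tabulate (λ j → j))))

    parts-InG : ∀ {Y : Subset n} {t} {S : Zfun r ℓ n} → InG Y t S → All (λ A → ∣ A ∣ ≡ t × A ⊆ Y) (parts S)
    parts-InG (SI-ok , S'-ok) = AllP.++⁺ (AllP.map⁺ (All.universal SI-ok (allSubsets ℓ)))
                                         (AllP.map⁺ (All.universal S'-ok (allFin (r ∸ 3))))

    -- Recording every part by its members encodes S injectively (up to ≈) as a
    -- list of 2^ℓ + r - 3 lists of t members of Y; hence there are at most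
    -- |Y|^s pairwise inequivalent S ∈ 𝒢^{r,t}_ℓ(Y).
    encode : Zfun r ℓ n → List (List (Fin n))
    encode S = map members (parts S)

    encode-∈ : ∀ {Y : Subset n} {t} {S : Zfun r ℓ n} → InG Y t S →
      encode S ∈ₚ tuples (2 ^ ℓ + (r ∸ 3)) (tuples t (members Y))
    encode-∈ {Y} {t} {S} S∈𝒢 = ∈-tuples _ _ (encode S) (trans (ListP.length-map members (parts S)) (length-parts S))
      (AllP.map⁺ (All.map members-tuple (parts-InG S∈𝒢)))
      where
      members-tuple : ∀ {A} → ∣ A ∣ ≡ t × A ⊆ Y → members A ∈ₚ tuples t (members Y)
      members-tuple {A} (size , A⊆Y) = ∈-tuples t (members Y) (members A) (trans (length-members A) size)
        (All.tabulate (λ x∈A → ∈-members (A⊆Y (members-∈ x∈A))))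

    inequivalent-bound : ∀ {Y : Subset n} {t} (W : List (Zfun r ℓ n)) → AllPairs (λ S T → ¬ S ≈ T) W →
      All (InG Y t) W → length W ≤ ∣ Y ∣ ^ sParam r ℓ t
    inequivalent-bound {Y} {t} W inequivalent W⊆𝒢 = begin
      length W                                                 ≡⟨ ListP.length-map encode W ⟨
      length (map encode W)                                    ≤⟨ Pigeonhole.unique-length-≤ (setoid _) encodings-distinct
                                                                    (AllP.map⁺ (All.map encode-∈ W⊆𝒢)) ⟩
      length (tuples K (tuples t (members Y)))                 ≡⟨ length-tuples K (tuples t (members Y)) ⟩
      length (tuples t (members Y)) ^ K                        ≡⟨ cong (_^ K) (trans (length-tuples t (members Y))
                                                                                     (cong (_^ t) (length-members Y))) ⟩
      (∣ Y ∣ ^ t) ^ K                                          ≡⟨ ℕP.^-*-assoc ∣ Y ∣ t K ⟩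
      ∣ Y ∣ ^ (t * K)                                          ≡⟨ cong (∣ Y ∣ ^_) (ℕP.*-comm t K) ⟩
      ∣ Y ∣ ^ sParam r ℓ t                                     ∎
      where
      open ℕP.≤-Reasoning
      K = 2 ^ ℓ + (r ∸ 3)
      encodings-distinct : AllPairs (λ a b → ¬ a ≡ b) (map encode W)
      encodings-distinct = AllPairsP.map⁺ (AllPairs.map (λ S≉T same → S≉T (ListP.map-injective members-injective same)) inequivalent)

  AtLeast-map : ∀ {r ℓ n M} {P Q : Zfun r ℓ n → Set} → (∀ {S} → P S → Q S) → AtLeast M P → AtLeast M Q
  AtLeast-map P⇒Q (L , distinct , all-P , large) = L , distinct , All.map P⇒Q all-P , large

  AtLeast-weaken : ∀ {r ℓ n M M′} {P : Zfun r ℓ n → Set} → M′ ℚ.≤ M → AtLeast M P → AtLeast M′ P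
  AtLeast-weaken M′≤M (L , distinct , all-P , large) = L , distinct , all-P , ℚP.≤-trans M′≤M large

module Arrows where

  open import Defs hiding (sym)
  open Subsets
  open Configurations
  open import Data.Bool using (true)
  open import Data.Nat using (ℕ)
  open import Data.Fin using (Fin)
  import Data.Fin.Properties as FinP
  open import Data.Fin.Subset using (_⊆_)
  open import Data.Fin.Subset.Properties using (_∈?_; _⊆?_)
  open import Data.Product using (_×_; _,_)
  import Data.Sum as Sum
  open import Function using (mk⇔)
  open import Relation.Nullary using (Dec; yes; does; ¬?; _×-dec_; _⊎-dec_; _→-dec_)
  open import Relation.Nullary.Decidable using (does-⇔; dec-true)
  open import Relation.Binary.PropositionalEquality

  module _ {r ℓ n : ℕ} where

    PairArrow? : ∀ (G : Graph n) x y i (S : Zfun r ℓ n) → Dec (PairArrow G x y i S)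
    PairArrow? G x y i S =
      FinP.all? (λ j → (S' S j ⊆? N G x) ×-dec (S' S j ⊆? N G y)) ×-dec
      (∀-subset? (λ I → (i ∈? I) →-dec (SI S I ⊆? N G x)) ×-dec
       ∀-subset? (λ I → ¬? (i ∈? I) →-dec (SI S I ⊆? N G y)))

    PairArrow-resp : ∀ (G : Graph n) x y i {S T : Zfun r ℓ n} → S ≈ T → PairArrow G x y i S → PairArrow G x y i T
    PairArrow-resp G x y i {S} {T} S≈T (S'-joined , SI-x , SI-y) with ≈⇒same-parts {S = S} {T} S≈T
    ... | same-SI , same-S' =
        (λ j → subst (λ A → A ⊆ N G x × A ⊆ N G y) (same-S' j) (S'-joined j))
      , (λ I i∈I → subst (_⊆ N G x) (same-SI I) (SI-x I i∈I))
      , (λ I i∉I → subst (_⊆ N G y) (same-SI I) (SI-y I i∉I))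

    arrowSet : Graph n → Fin ℓ → Zfun r ℓ n → EdgeSet n
    arrowSet G i S x y = does (PairArrow? G x y i S ⊎-dec PairArrow? G y x i S)

    arrowSet-sym : ∀ G i S x y → arrowSet G i S x y ≡ arrowSet G i S y x
    arrowSet-sym G i S x y = does-⇔ (mk⇔ Sum.swap Sum.swap) (PairArrow? G x y i S ⊎-dec PairArrow? G y x i S)
                                                          (PairArrow? G y x i S ⊎-dec PairArrow? G x y i S)

    arrowSet-resp : ∀ G i {S T : Zfun r ℓ n} → S ≈ T → ∀ x y → arrowSet G i S x y ≡ arrowSet G i T x y
    arrowSet-resp G i {S} {T} S≈T x y = does-⇔
      (mk⇔ (Sum.map (PairArrow-resp G x y i S≈T) (PairArrow-resp G y x i S≈T))
           (Sum.map (PairArrow-resp G x y i (sym S≈T)) (PairArrow-resp G y x i (sym S≈T))))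
      (PairArrow? G x y i S ⊎-dec PairArrow? G y x i S) (PairArrow? G x y i T ⊎-dec PairArrow? G y x i T)

    arrowSet⇒EdgeArrow : ∀ G i S (e : Edge n) → e ∈E arrowSet G i S → EdgeArrow G e i S
    arrowSet⇒EdgeArrow G i S e = witness (PairArrow? G (u e) (v e) i S ⊎-dec PairArrow? G (v e) (u e) i S)
      where
      witness : ∀ {P : Set} (P? : Dec P) → does P? ≡ true → P
      witness (yes p) _ = p

    EdgeArrow⇒arrowSet : ∀ G i S (e : Edge n) → EdgeArrow G e i S → e ∈E arrowSet G i S
    EdgeArrow⇒arrowSet G i S e = dec-true (PairArrow? G (u e) (v e) i S ⊎-dec PairArrow? G (v e) (u e) i S)

module EdgeSequences where

  open import Defs
  open import Data.Nat as ℕ using (ℕ; zero; suc; _<_)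
  import Data.Fin as Fin
  open import Data.List using (List; []; _∷_; _++_; [_]; length)
  open import Data.Maybe using (just)
  open import Relation.Binary.PropositionalEquality using (_≡_; refl)

  private
    variable
      A : Set

  nth-++ : ∀ (es fs : List A) i {e} → nth es i ≡ just e → nth (es ++ fs) i ≡ just e
  nth-++ (x ∷ es) fs zero    found = found
  nth-++ (x ∷ es) fs (suc i) found = nth-++ es fs i found

  nth-++-< : ∀ (es fs : List A) i → i < length es → nth (es ++ fs) i ≡ nth es i
  nth-++-< (x ∷ es) fs zero    _           = refl
  nth-++-< (x ∷ es) fs (suc i) (ℕ.s≤s i<) = nth-++-< es fs i i<

  nth-last : ∀ (es : List A) e → nth (es ++ [ e ]) (length es) ≡ just e
  nth-last []       e = refl
  nth-last (x ∷ es) e = nth-last es e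

  InChain-extend : ∀ {n} (D : DFam n) es e → InChain D es → e ∈E D es → InChain D (es ++ [ e ])
  InChain-extend D []       e chain e∈D Fin.zero    = e∈D
  InChain-extend D (x ∷ es) e chain e∈D Fin.zero    = chain Fin.zero
  InChain-extend D (x ∷ es) e chain e∈D (Fin.suc k) =
    InChain-extend (λ fs → D (x ∷ fs)) es e (λ k′ → chain (Fin.suc k′)) e∈D k

module GoodCounting {n : ℕ} (G : Graph n) (X Y : Subset n) (r ℓ t : ℕ) (α C : ℚ)
                 (α≥0 : 0ℚ ℚ.≤ α) (C≥0 : 0ℚ ℚ.≤ C) (D : DFam n) (rich : RichWitness G X Y r ℓ t C α D) where

  open import Defs hiding (sym)
  open import Data.Nat as ℕ using (ℕ; zero; suc; _+_; _*_; _^_; _≤_; _<_)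
  open import Data.Fin.Subset using (Subset; ∣_∣)
  open import Data.Rational as ℚ using (ℚ; 0ℚ)

  open FiniteSums
  open Rationals
  open EdgeSets
  open AverageDegree
  open Lists
  open Arrows
  open Configurations
  open EdgeSequences
  open import Data.Bool using (Bool; true; false; _∧_)
  import Data.Bool.Properties as BoolP
  import Data.Nat.Properties as ℕP
  open import Data.Fin as Fin using (Fin; toℕ)
  import Data.Fin.Properties as FinP
  open import Data.List using (List; []; _++_; [_]; length; filter)
  import Data.List.Properties as ListP
  open import Data.List.Relation.Unary.All as All using (All; [])
  import Data.List.Relation.Unary.All.Properties as AllP
  open import Data.List.Relation.Unary.AllPairs as AllPairs using (AllPairs; [])
  import Data.List.Relation.Unary.AllPairs.Properties as AllPairsP
  import Data.List.Membership.DecSetoid as DecSetoidMembership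
  import Data.List.Relation.Unary.Any as Any
  open import Data.Maybe using (just)
  import Data.Rational.Properties as ℚP
  open import Data.Product using (Σ; _×_; _,_; proj₁; proj₂; uncurry)
  open import Data.Empty using (⊥-elim)
  open import Function using (_∘_)
  open import Relation.Nullary using (¬_; Dec; yes; no; does)
  open import Relation.Binary.PropositionalEquality hiding ([_])

  Config : Set
  Config = Zfun r ℓ n

  c : ℚ
  c = 2^- ℓ ℚ.* α ℚ.* C

  Yˢ : ℚ
  Yˢ = fromℕ (∣ Y ∣ ^ sParam r ℓ t)

  Suitable : Fin ℓ → Config → EdgeSet n → Set
  Suitable k S E = EdgeSetIn G X E × AvgDegAtLeast E c × (∀ e → e ∈E E → EdgeArrow G e k S)

  -- Since the
  -- edges of the E_k are joined to S one at a time, this implies goodness.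
  StronglyGood : List (Edge n) → Config → Set
  StronglyGood es S =
    InF G Y t S ×
    (∀ i e → nth es (toℕ i) ≡ just e → EdgeArrow G e i S) ×
    Σ (Fin ℓ → EdgeSet n) λ E → ∀ k → length es ≤ toℕ k → Suitable k S (E k)

  StronglyGood⇒Good : ∀ {es S} → StronglyGood es S → Good G X Y t C α es S
  StronglyGood⇒Good {es} {S} (S∈ℱ , fixed , E , suitable) =
    S∈ℱ , E , (λ k q≤k → proj₁ (suitable k q≤k) , proj₁ (proj₂ (suitable k q≤k))) , completion
    where
    completion : ∀ fs → length (es ++ fs) ≡ ℓ →
      (∀ k e → length es ≤ toℕ k → nth (es ++ fs) (toℕ k) ≡ just e → e ∈E E k) → TupleArrow G (es ++ fs) S
    completion fs len chosen = len , arrow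
      where
      arrow : ∀ i e → nth (es ++ fs) (toℕ i) ≡ just e → EdgeArrow G e i S
      arrow i e found with toℕ i ℕ.<? length es
      ... | yes i<q = fixed i e (trans (sym (nth-++-< es fs (toℕ i) i<q)) found)
      ... | no  i≮q = proj₂ (proj₂ (suitable i (ℕP.≮⇒≥ i≮q))) e (chosen i e (ℕP.≮⇒≥ i≮q) found)

  Claim : ℕ → Set
  Claim m = ∀ es → length es + m ≡ ℓ → InChain D es → AtLeast (target α Yˢ m) (StronglyGood es)

  -- With no edge left to choose, richness itself provides the functions.
  base : Claim 0
  base es len chain = AtLeast-weaken (ℚP.≤-reflexive (cong (ℚ._* Yˢ) (ℚP.*-identityˡ α)))
    (AtLeast-map strengthen (proj₂ (proj₂ rich) es chain complete))
    where
    complete : length es ≡ ℓ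
    complete = trans (sym (ℕP.+-identityʳ (length es))) len
    strengthen : ∀ {S} → InF G Y t S × TupleArrow G es S → StronglyGood es S
    strengthen (S∈ℱ , _ , arrows) = S∈ℱ , arrows , (λ _ _ _ → false) ,
      λ k q≤k → ⊥-elim (ℕP.<-irrefl refl (ℕP.<-≤-trans (FinP.toℕ<n k) (subst (_≤ toℕ k) complete q≤k)))

  module Step {m} (es : List (Edge n)) (len : length es + suc m ≡ ℓ) (chain : InChain D es) (IH : Claim m) where

    q : ℕ
    q = length es

    q<ℓ : q < ℓ
    q<ℓ = subst (q <_) len (ℕP.m<m+n q ℕ.z<s)

    m<ℓ : suc m ≤ ℓ
    m<ℓ = subst (suc m ≤_) len (ℕP.m≤n+m (suc m) q)

    i₀ : Fin ℓ
    i₀ = Fin.fromℕ< q<ℓ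

    Dq : EdgeSet n
    Dq = D es

    Dq-simple : Simple Dq
    Dq-simple = EdgeSetIn⇒Simple G (proj₁ rich es)

    δ>C : C ℚ.< fromℕ (δ Dq)
    δ>C = proj₁ (proj₂ rich) es chain q<ℓ

    B : Config → EdgeSet n
    B S x y = Dq x y ∧ arrowSet G i₀ S x y

    B⊆Dq : ∀ S x y → B S x y ≡ true → Dq x y ≡ true
    B⊆Dq S x y = BoolP.∧-conicalˡ _ _

    B-in : ∀ S → EdgeSetIn G X (B S)
    B-in S = (λ x y → cong₂ _∧_ (proj₁ (proj₁ rich es) x y) (arrowSet-sym G i₀ S x y))
           , (λ x y xy∈B → proj₂ (proj₁ rich es) x y (B⊆Dq S x y xy∈B))

    Extends : Config → Set
    Extends S = Σ (Edge n) λ e → StronglyGood (es ++ [ e ]) S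

    refine : ∀ {S} → Extends S → AvgDegAtLeast (B S) c → StronglyGood es S
    refine {S} (e , S∈ℱ , fixed , E , suitable) dense = S∈ℱ , fixed′ , (λ k → choose k (toℕ k ℕ.≟ q)) ,
      λ k q≤k → choose-suitable k q≤k (toℕ k ℕ.≟ q)
      where
      fixed′ : ∀ i e′ → nth es (toℕ i) ≡ just e′ → EdgeArrow G e′ i S
      fixed′ i e′ found = fixed i e′ (nth-++ es [ e ] (toℕ i) found)
      B-suitable : Suitable i₀ S (B S)
      B-suitable = B-in S , dense , λ e′ e′∈B → arrowSet⇒EdgeArrow G i₀ S e′ (BoolP.∧-conicalʳ (Dq (u e′) (v e′)) _ e′∈B)
      choose : ∀ k → Dec (toℕ k ≡ q) → EdgeSet n
      choose k (yes _) = B S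
      choose k (no _)  = E k
      choose-suitable : ∀ k → q ≤ toℕ k → (k≟q : Dec (toℕ k ≡ q)) → Suitable k S (choose k k≟q)
      choose-suitable k q≤k (yes k≡q) =
        subst (λ j → Suitable j S (B S)) (FinP.toℕ-injective (trans (FinP.toℕ-fromℕ< q<ℓ) (sym k≡q))) B-suitable
      choose-suitable k q≤k (no k≢q) =
        suitable k (subst (_≤ toℕ k) (sym (trans (ListP.length-++ es) (ℕP.+-comm q 1))) (ℕP.≤∧≢⇒< q≤k (k≢q ∘ sym)))

    record Contribution (x y : Fin n) : Set where
      field
        list     : List Config
        distinct : AllPairs Distinct list
        extends  : All Extends list
        on-edge  : All (λ S → listed (B S) x y ≡ true) list
        large    : fromℕ (𝟙 (listed Dq x y)) ℚ.* target α Yˢ m ℚ.≤ fromℕ (length list)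

    contribution : ∀ x y → Contribution x y
    contribution x y = contribute (listed Dq x y) refl
      where
      contribute : ∀ b → listed Dq x y ≡ b → Contribution x y
      contribute false unlisted = record
        { list = [] ; distinct = [] ; extends = [] ; on-edge = []
        ; large = subst (λ b → fromℕ (𝟙 b) ℚ.* target α Yˢ m ℚ.≤ 0ℚ) (sym unlisted)
                        (ℚP.≤-reflexive (ℚP.*-zeroˡ (target α Yˢ m))) }
      contribute true xy-listed = from-supplied (IH (es ++ [ e ]) extended (InChain-extend D es e chain xy∈Dq))
        where
        xy∈Dq : Dq x y ≡ true
        xy∈Dq = proj₁ (listed⇒ Dq x y xy-listed)
        x<y : toℕ x < toℕ y
        x<y = proj₂ (listed⇒ Dq x y xy-listed)
        e : Edge n
        e = edge x y x<y
        extended : length (es ++ [ e ]) + m ≡ ℓ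
        extended = trans (cong (_+ m) (ListP.length-++ es)) (trans (ℕP.+-assoc q 1 m) len)
        on-edge : ∀ {S} → StronglyGood (es ++ [ e ]) S → listed (B S) x y ≡ true
        on-edge {S} (_ , fixed , _) = ⇒listed (B S) x y (cong₂ _∧_ xy∈Dq joined) x<y
          where
          joined : arrowSet G i₀ S x y ≡ true
          joined = EdgeArrow⇒arrowSet G i₀ S e
            (fixed i₀ e (trans (cong (nth (es ++ [ e ])) (FinP.toℕ-fromℕ< q<ℓ)) (nth-last es e)))
        from-supplied : AtLeast (target α Yˢ m) (StronglyGood (es ++ [ e ])) → Contribution x y
        from-supplied (L , distinct , good , large) = record
          { list = L ; distinct = distinct ; extends = All.map (e ,_) good ; on-edge = All.map on-edge good
          ; large = subst (λ b → fromℕ (𝟙 b) ℚ.* target α Yˢ m ℚ.≤ fromℕ (length L)) (sym xy-listed)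
                          (subst (ℚ._≤ fromℕ (length L)) (sym (ℚP.*-identityˡ (target α Yˢ m))) large) }

    open DoubleCounting (Equivalence {r} {ℓ} {n})
    open DecSetoidMembership (Equivalence {r} {ℓ} {n}) using (_∈_; _∈?_)

    contributed : Fin n × Fin n → List Config
    contributed (x , y) = Contribution.list (contribution x y)

    W : List Config
    W = gathered (pairs n) contributed

    good? : ∀ S → Dec (AvgDegAtLeast (B S) c)
    good? S = AvgDegAtLeast? (B S) c

    P : List Config
    P = filter good? W

    W-extends : All Extends W
    W-extends = gathered-all (pairs n) contributed
      (All.tabulate λ {(x , y)} _ → Contribution.extends (contribution x y))

    P-distinct : AllPairs Distinct P
    P-distinct = AllPairs.map (λ {S} {T} → ≉⇒Distinct {S = S} {T})
      (AllPairsP.filter⁺ good? (gathered-unique (pairs n) contributed))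

    P-good : All (StronglyGood es) P
    P-good = All.zipWith (uncurry refine) (AllP.filter⁺ good? W-extends , AllP.all-filter good? W)

    -- Each S in W is contributed only along edges of B S.
    multiplicity≤ : ∀ S → multiplicity (pairs n) contributed S ≤ numEdges (B S)
    multiplicity≤ S = begin
      ∑[ p ∈ pairs n ] 𝟙 (does (S ∈? contributed p))
        ≤⟨ ∑-mono (pairs n) (λ {(x , y)} _ → 𝟙-does-mono (S ∈? contributed (x , y)) (on-edge x y)) ⟩
      ∑[ p ∈ pairs n ] 𝟙 (uncurry (listed (B S)) p)
        ≡⟨ numEdges-pairs (B S) ⟨
      numEdges (B S)
        ∎
      where
      open ℕP.≤-Reasoning
      on-edge : ∀ x y → S ∈ contributed (x , y) → listed (B S) x y ≡ true
      on-edge x y S∈ with All.lookupAny (Contribution.on-edge (contribution x y)) S∈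
      ... | T-listed , S≈T =
        trans (cong (λ b → (Dq x y ∧ b) ∧ (toℕ x ℕ.<ᵇ toℕ y)) (arrowSet-resp G i₀ {S} {Any.lookup S∈} S≈T x y)) T-listed

    Ne : ℕ
    Ne = numEdges Dq

    κ : ℚ
    κ = 2^- ℓ ℚ.* α ℚ.* fromℕ Ne

    edges≤ : ∀ S → fromℕ (numEdges (B S)) ℚ.≤ fromℕ (𝟙 (does (good? S)) * Ne) ℚ.+ κ
    edges≤ S = bound (good? S)
      where
      β≥0 : 0ℚ ℚ.≤ 2^- ℓ ℚ.* α
      β≥0 = *-nonNeg (2^-nonNeg ℓ) α≥0
      bound : (good : Dec (AvgDegAtLeast (B S) c)) →
        fromℕ (numEdges (B S)) ℚ.≤ fromℕ (𝟙 (does good) * Ne) ℚ.+ κ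
      bound (yes _) = ℚP.≤-trans (fromℕ-mono (numEdges-mono (B S) Dq (B⊆Dq S)))
        (subst (λ k → fromℕ Ne ℚ.≤ fromℕ k ℚ.+ κ) (sym (ℕP.*-identityˡ Ne))
               (≤-+-nonNeg (*-nonNeg β≥0 (fromℕ-nonNeg Ne))))
      bound (no sparse) = ℚP.≤-trans
        (sparse-part β≥0 C≥0 (EdgeSetIn⇒Simple G (B-in S)) (B⊆Dq S) (minDegree-bound Dq-simple δ>C) sparse)
        (ℚP.≤-reflexive (sym (ℚP.+-identityˡ κ)))

    -- Counting the pairs (S , xy) with S contributed along xy in two ways.
    counted : fromℕ Ne ℚ.* target α Yˢ m ℚ.≤ fromℕ (length P * Ne) ℚ.+ fromℕ (length W) ℚ.* κ
    counted = begin
      fromℕ Ne ℚ.* target α Yˢ m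
        ≡⟨ cong (λ k → fromℕ k ℚ.* target α Yˢ m) (numEdges-pairs Dq) ⟩
      fromℕ (∑[ p ∈ pairs n ] 𝟙 (uncurry (listed Dq) p)) ℚ.* target α Yˢ m
        ≤⟨ ∑-scaled-≤ (pairs n) _ _ _ (λ (x , y) → Contribution.large (contribution x y)) ⟩
      fromℕ (∑[ p ∈ pairs n ] length (contributed p))
        ≤⟨ fromℕ-mono (double-counting (pairs n) contributed unique) ⟩
      fromℕ (∑[ S ∈ W ] multiplicity (pairs n) contributed S)
        ≤⟨ fromℕ-mono (∑-mono W (λ {S} _ → multiplicity≤ S)) ⟩
      fromℕ (∑[ S ∈ W ] numEdges (B S))
        ≤⟨ ∑-≤-+const W _ _ κ edges≤ ⟩
      fromℕ (∑[ S ∈ W ] (𝟙 (does (good? S)) * Ne)) ℚ.+ fromℕ (length W) ℚ.* κ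
        ≡⟨ cong (λ k → fromℕ k ℚ.+ fromℕ (length W) ℚ.* κ) good-count ⟩
      fromℕ (length P * Ne) ℚ.+ fromℕ (length W) ℚ.* κ
        ∎
      where
      open ℚP.≤-Reasoning
      unique : All (λ p → AllPairs (λ S T → ¬ S ≈ T) (contributed p)) (pairs n)
      unique = All.tabulate λ {(x , y)} _ →
        AllPairs.map (λ {S} {T} → Distinct⇒≉ {S = S} {T}) (Contribution.distinct (contribution x y))
      good-count : ∑[ S ∈ W ] (𝟙 (does (good? S)) * Ne) ≡ length P * Ne
      good-count = trans (∑-*ʳ W (𝟙 ∘ does ∘ good?) Ne) (cong (_* Ne) (sym (length-filter good? W)))

    result : AtLeast (target α Yˢ (suc m)) (StronglyGood es)
    result = P , P-distinct , P-good ,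
      halving-step α≥0 (fromℕ-nonNeg (∣ Y ∣ ^ sParam r ℓ t)) m<ℓ (minDegree-edge Dq-simple C≥0 δ>C)
        (length P) (length W) W≤Yˢ counted
      where
      W≤Yˢ : fromℕ (length W) ℚ.≤ Yˢ
      W≤Yˢ = fromℕ-mono (inequivalent-bound W (gathered-unique (pairs n) contributed)
                                              (All.map (proj₁ ∘ proj₁ ∘ proj₂) W-extends))

  claim : ∀ m → Claim m
  claim zero    = base
  claim (suc m) es len chain = Step.result es len chain (claim m)

open import Defs
open import Data.Nat using (ℕ; _≤_; _∸_; _+_; _^_; z≤n)
import Data.Nat.Properties as ℕP
open import Data.Nat.ListAction using (sum)
open import Data.Fin using (Fin)
open import Data.Fin.Subset using (Subset; ∣_∣)
open import Data.List using (List; []; length; map; allFin)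
open import Data.Product using (_×_; _,_; proj₁; proj₂)
open import Data.Rational using (Positive; _*_)
import Data.Rational.Properties as ℚP
open import Relation.Binary.PropositionalEquality using (_≡_; refl)
open Rationals using (*-nonNeg; fromℕ-nonNeg)
open Configurations using (AtLeast-map)

Cconst-nonNeg : ∀ ℓ α (αpos : Positive α) m → 0ℚ ℚ.≤ Cconst ℓ α αpos m
Cconst-nonNeg ℓ α αpos m = *-nonNeg (*-nonNeg (fromℕ-nonNeg (2 ^ (ℓ + 3))) α⁻¹≥0) (fromℕ-nonNeg (sum (map m (allFin ℓ))))
  where
  α⁻¹≥0 : 0ℚ ℚ.≤ inv α αpos
  α⁻¹≥0 = ℚP.<⇒≤ (ℚP.positive⁻¹ (inv α αpos) {{ℚP.1/pos⇒pos α {{αpos}}}})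

lemma5p6 : ∀ {n} (G : Graph n) (X Y : Subset n) → DisjointS X Y →
    (r ℓ t : ℕ) → 3 ≤ r →
    (α : ℚ) (αpos : Positive α) →
    (m : Fin ℓ → ℕ) (T : (i : Fin ℓ) → Graph (m i)) → (∀ i → IsTree (T i)) →
    (D : DFam n) →
    RichWitness G X Y r ℓ t (Cconst ℓ α αpos m) α D →
    (∀ (q : ℕ) → q ≤ ℓ → (es : List (Edge n)) → length es ≡ q → InChain D es →
       AtLeast {r} {ℓ} {n}
         ((2^- (ℓ ∸ q)) * α * fromℕ (∣ Y ∣ ^ sParam r ℓ t))
         (λ S → InF G Y t S × Good G X Y t (Cconst ℓ α αpos m) α es S))
    × Dense G X Y r ℓ t (Cconst ℓ α αpos m) α
lemma5p6 {n} G X Y _ r ℓ t _ α αpos m _ _ D rich = good-functions , dense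
  where
  C : ℚ
  C = Cconst ℓ α αpos m
  α≥0 : 0ℚ ℚ.≤ α
  α≥0 = ℚP.<⇒≤ (ℚP.positive⁻¹ α {{αpos}})
  open GoodCounting G X Y r ℓ t α C α≥0 (Cconst-nonNeg ℓ α αpos m) D rich using (claim; StronglyGood⇒Good)
  good-functions : ∀ q → q ≤ ℓ → (es : List (Edge n)) → length es ≡ q → InChain D es →
    AtLeast ((2^- (ℓ ∸ q)) * α * fromℕ (∣ Y ∣ ^ sParam r ℓ t)) (λ S → InF G Y t S × Good G X Y t C α es S)
  good-functions q q≤ℓ es refl chain =
    AtLeast-map (λ good → proj₁ good , StronglyGood⇒Good {es} good) (claim (ℓ ∸ q) es (ℕP.m+[n∸m]≡n q≤ℓ) chain)
  dense : Dense G X Y r ℓ t C α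
  dense = AtLeast-map proj₂ (good-functions 0 z≤n [] refl (λ ()))
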